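{- For every $n\ge 1$ and every $\pi\in\mathcal{S}_n$, \[\mathrm{IPF}(n,\pi)=n!\cdot\mathrm{PF}(n,\pi)=n!\prod_{i=1}^n a_i(\pi),\qquad \mathrm{IPF}(n)=n!\cdot\mathrm{PF}(n)=n!\,(n+1)^{n-1}.\]
   Context: Let $[n]=\{1,\dots,n\}$, $\mathcal{S}_n$ the permutations of $[n]$ in one-line notation, and $\pi_i^{ -1}$ the position $j$ with $\pi_j=i$. A tuple $(C_1,\dots,C_n)$ of non-empty subsets of $[n]$ is a subset parking function with outcome $\pi$ if for every $1\le i\le n$, $\pi_i^{ -1}$ is the smallest element of $C_i\setminus\{\pi_{i'}^{ -1}:i'<i\}$. It is an interval parking function if every $C_i$ is an interval $\{a,a+1,\dots,b\}\subseteq[n]$; $\mathrm{IPF}(n,\pi)$ counts interval parking functions with outcome $\pi$ and $\mathrm{IPF}(n)=\sum_\pi\mathrm{IPF}(n,\pi)$. A (classical) parking function is a subset parking function with every $C_i$ of the form $[c_i,n]=\{c_i,\dots,n\}$; $\mathrm{PF}(n,\pi)$ counts these with outcome $\pi$ and $\mathrm{PF}(n)$ counts all of them. For $1\le i\le n$, $a_i(\pi)$ is the largest $j$ with $1\le j\le i$ such that $\pi_i\ge\pi_{i'}$ for all $i-j+1\le i'\le i$. -}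

module Defs where

open import Data.Nat using (ℕ; zero; suc; _+_; _*_; _∸_; _⊔_; _≤?_)
  renaming (_≤_ to _≤ℕ_)
open import Data.Bool using (Bool; _∧_)
open import Data.Fin using (Fin; toℕ; _≤_; _<_)
open import Data.Fin.Properties using (all?; any?) renaming (_≤?_ to _≤ᶠ?_; _<?_ to _<ᶠ?_; _≟_ to _≟ᶠ_)
open import Data.Fin.Subset using (Subset; _∈_)
open import Data.Fin.Subset.Properties using (_∈?_)
open import Data.Vec using (Vec; []; _∷_; lookup; tabulate)
import Data.Vec as Vec
open import Data.List using (List; []; _∷_; map; concatMap; filter; length; allFin; cartesianProduct; upTo; foldr)
open import Data.Nat.ListAction using (product)
open import Data.List.Relation.Unary.Any using (Any)
  renaming (any? to anyL?)
open import Data.Product using (Σ; ∃; ∃-syntax; _×_; _,_; proj₁; proj₂)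
open import Relation.Binary.PropositionalEquality using (_≡_)
open import Relation.Nullary using (Dec; yes; no; ¬_; does)
open import Relation.Nullary.Decidable using (_×-dec_; _→-dec_; ¬?)
open import Relation.Unary using (Decidable)

count : ∀ {a p} {A : Set a} {P : A → Set p} → Decidable P → List A → ℕ
count P? xs = length (filter P? xs)

allVecs : ∀ {a} {A : Set a} → List A → (k : ℕ) → List (Vec A k)
allVecs xs zero = [] ∷ []
allVecs xs (suc k) = concatMap (λ x → map (x ∷_) (allVecs xs k)) xs

-- [n] is modelled by Fin n (0-based: element j of Fin n stands for j+1).
-- A permutation in one-line notation is a vector π with π_j = lookup π j.

IsPerm : ∀ {n} → Vec (Fin n) n → Set
IsPerm {n} π = ∀ (p q : Fin n) → lookup π p ≡ lookup π q → p ≡ q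

isPerm? : ∀ {n} → (π : Vec (Fin n) n) → Dec (IsPerm π)
isPerm? π = all? (λ p → all? (λ q → (lookup π p ≟ᶠ lookup π q) →-dec (p ≟ᶠ q)))

perms : (n : ℕ) → List (Vec (Fin n) n)
perms n = filter isPerm? (allVecs (allFin n) n)

-- k ∈ {π⁻¹_{i'} : i' < i}  (π⁻¹_{i'} is the position k with π_k = i')
Taken : ∀ {n} → Vec (Fin n) n → Fin n → Fin n → Set
Taken π i k = ∃[ i' ] (i' < i × lookup π k ≡ i')

Avail : ∀ {n} → Vec (Fin n) n → Vec (Subset n) n → Fin n → Fin n → Set
Avail π C i k = k ∈ lookup C i × ¬ Taken π i k

IsMin : ∀ {n} → (Fin n → Set) → Fin n → Set
IsMin S p = S p × (∀ k → S k → p ≤ k)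

-- (C_1,…,C_n) is a subset parking function with outcome π:
-- for every car i, π⁻¹_i (the position p with π_p = i) is the smallest
-- element of C_i \ {π⁻¹_{i'} : i' < i}.
Outcome : ∀ {n} → Vec (Fin n) n → Vec (Subset n) n → Set
Outcome {n} π C = ∀ (i p : Fin n) → lookup π p ≡ i → IsMin (Avail π C i) p

taken? : ∀ {n} (π : Vec (Fin n) n) i k → Dec (Taken π i k)
taken? π i k = any? (λ i' → (i' <ᶠ? i) ×-dec (lookup π k ≟ᶠ i'))

avail? : ∀ {n} π (C : Vec (Subset n) n) i k → Dec (Avail π C i k)
avail? π C i k = (k ∈? lookup C i) ×-dec ¬? (taken? π i k)

outcome? : ∀ {n} (π : Vec (Fin n) n) (C : Vec (Subset n) n) → Dec (Outcome π C)
outcome? π C = all? (λ i → all? (λ p → (lookup π p ≟ᶠ i) →-dec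
  (avail? π C i p ×-dec all? (λ k → avail? π C i k →-dec (p ≤ᶠ? k)))))

interval : ∀ {n} → Fin n → Fin n → Subset n
interval a b = tabulate (λ k → does (a ≤ᶠ? k) ∧ does (k ≤ᶠ? b))

-- all non-empty intervals, as pairs (a , b) with a ≤ b (distinct pairs
-- give distinct intervals)
intervals : (n : ℕ) → List (Fin n × Fin n)
intervals n = filter (λ ab → proj₁ ab ≤ᶠ? proj₂ ab) (cartesianProduct (allFin n) (allFin n))

toIntervals : ∀ {n k} → Vec (Fin n × Fin n) k → Vec (Subset n) k
toIntervals = Vec.map (λ ab → interval (proj₁ ab) (proj₂ ab))

IPF : (n : ℕ) → Vec (Fin n) n → ℕ
IPF n π = count (λ v → outcome? π (toIntervals v)) (allVecs (intervals n) n)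

IPFtotal : ℕ → ℕ
IPFtotal n = foldr _+_ 0 (map (IPF n) (perms n))

-- Classical parking functions: C_i = [c_i, n]

upper : ∀ {n} → Fin n → Subset n
upper c = tabulate (λ k → does (c ≤ᶠ? k))

toUppers : ∀ {n k} → Vec (Fin n) k → Vec (Subset n) k
toUppers = Vec.map upper

PF : (n : ℕ) → Vec (Fin n) n → ℕ
PF n π = count (λ c → outcome? π (toUppers c)) (allVecs (allFin n) n)

PFtotal : ℕ → ℕ
PFtotal n = count (λ c → anyL? (λ π → outcome? π (toUppers c)) (perms n)) (allVecs (allFin n) n)

-- a_i(π): largest j with 1 ≤ j ≤ i such that π_i ≥ π_{i'} for all
-- i-j+1 ≤ i' ≤ i.  With 0-based position i (= 1-based i+1), j ranges over
-- 1 … i+1 and the window is the 0-based positions p with (i+1)-j ≤ p ≤ i.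

WindowOK : ∀ {n} → Vec (Fin n) n → Fin n → ℕ → Set
WindowOK {n} π i j = ∀ (p : Fin n) → (suc (toℕ i) ∸ j) ≤ℕ toℕ p → p ≤ i → lookup π p ≤ lookup π i

windowOK? : ∀ {n} (π : Vec (Fin n) n) i j → Dec (WindowOK π i j)
windowOK? π i j = all? (λ p → ((suc (toℕ i) ∸ j) ≤? toℕ p) →-dec ((p ≤ᶠ? i) →-dec (lookup π p ≤ᶠ? lookup π i)))

a : ∀ {n} → Vec (Fin n) n → Fin n → ℕ
a π i = foldr _⊔_ 0 (filter (windowOK? π i) (map suc (upTo (suc (toℕ i)))))

prodA : ∀ {n} → Vec (Fin n) n → ℕ
prodA {n} π = product (map (a π) (allFin n))

-- The outcome condition splits into one condition per car, and
-- the car parked at spot p parks there with preference set S iff p ∈ S and every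
-- spot of S left of p holds a car with a smaller label (ParksAt). For S = [c, n]
-- this says c ≤ p and [c, p] is a window in the definition of a_p(π); the map
-- c ↦ p + 1 - c turns these c into the window lengths, a downward closed set whose
-- size equals its maximum a_p(π). For S = [x, y] the left end x is as before and y
-- ranges freely over [p, n], giving a_p(π) · (n - p) choices. The product principle
-- over the cars, reindexed by π, yields PF(n, π) = ∏ a_p(π) and
-- IPF(n, π) = ∏ a_p(π) (n - p) = n! ∏ a_p(π).
--
-- A preference vector has at most one outcome, so PF(n) = Σ_π PF(n, π) and
-- summing the first identity over S_n gives IPF(n) = n! · PF(n). Finally
-- PF(n) = (n + 1)^(n-1) by Pollak's argument: parking n cars on n + 1 spots arranged
-- in a circle always leaves exactly one spot free, by rotational symmetry every spot
-- is the free one for (n + 1)^(n-1) of the (n + 1)^n preference sequences, and the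
-- sequences leaving spot 0 free are exactly the classical parking functions (shifted
-- by one).
module Submission where

module Counting where

  open import Defs using (count; allVecs)
  open import Data.Nat using (ℕ; zero; suc; _+_; _*_; _^_; _<_)
  open import Data.Nat.Properties using (+-identityʳ; *-distribʳ-+; *-distribˡ-+; +-assoc; +-comm; *-zeroʳ; *-1-commutativeMonoid)
  open import Data.Nat.ListAction using (sum)
  open import Data.List using (List; filter; []; _∷_; [_]; _∷ʳ_; _++_; map; length; concatMap; cartesianProduct)
  open import Data.List.Properties using (length-++; filter-++; filter-≐; filter-none; filter-all; map-cong)
  open import Data.List.Relation.Unary.All using (All; []; _∷_; universal)
  open import Data.Vec using (Vec; []; _∷_; lookup)
  open import Data.Fin using (Fin; zero; suc)
  open import Data.Product using (∃; _×_; _,_; proj₁; proj₂)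
  open import Data.Sum using (_⊎_; inj₁; inj₂)
  open import Relation.Binary.PropositionalEquality using (_≡_; refl; sym; trans; cong; cong₂; module ≡-Reasoning)
  open import Relation.Nullary using (Dec; yes; no; ¬_)
  open import Relation.Unary using (Decidable; _≐_)
  open import Data.Empty using (⊥-elim)
  open import Function using (_∘_)
  open import Data.Unit using (tt)

  variable
    A B : Set

  ind : ∀ {p} {P : Set p} → Dec P → ℕ
  ind (yes _) = 1
  ind (no _)  = 0

  ind-no : ∀ {P : Set} (d : Dec P) → ¬ P → ind d ≡ 0
  ind-no (yes p) ¬p = ⊥-elim (¬p p)
  ind-no (no _)  _  = refl

  open import Algebra.Properties.CommutativeMonoid.Sum *-1-commutativeMonoid public
    using () renaming (sum to ∏)

  count-∷ : {P : A → Set} (P? : Decidable P) → ∀ x xs → count P? (x ∷ xs) ≡ ind (P? x) + count P? xs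
  count-∷ P? x xs with P? x
  ... | yes _ = refl
  ... | no _  = refl

  count-yes : {P : A → Set} (P? : Decidable P) → ∀ {x} xs → P x → count P? (x ∷ xs) ≡ suc (count P? xs)
  count-yes P? {x} xs px with P? x
  ... | yes _ = refl
  ... | no ¬p = ⊥-elim (¬p px)

  count-no : {P : A → Set} (P? : Decidable P) → ∀ {x} xs → ¬ P x → count P? (x ∷ xs) ≡ count P? xs
  count-no P? {x} xs ¬px with P? x
  ... | yes p = ⊥-elim (¬px p)
  ... | no _  = refl

  count-++ : {P : A → Set} (P? : Decidable P) → ∀ xs ys → count P? (xs ++ ys) ≡ count P? xs + count P? ys
  count-++ P? xs ys = trans (cong length (filter-++ P? xs ys)) (length-++ (filter P? xs))

  count-∷ʳ : {P : A → Set} (P? : Decidable P) → ∀ xs x →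
    count P? (xs ∷ʳ x) ≡ count P? xs + ind (P? x)
  count-∷ʳ P? xs x = trans (count-++ P? xs [ x ])
    (cong (count P? xs +_) (trans (count-∷ P? x []) (+-identityʳ (ind (P? x)))))

  count-concatMap : {P : A → Set} (P? : Decidable P) (h : B → List A) → ∀ ys →
    count P? (concatMap h ys) ≡ sum (map (count P? ∘ h) ys)
  count-concatMap P? h []       = refl
  count-concatMap P? h (y ∷ ys) =
    trans (count-++ P? (h y) (concatMap h ys)) (cong (count P? (h y) +_) (count-concatMap P? h ys))

  count-map : {P : A → Set} (P? : Decidable P) (f : B → A) → ∀ ys → count P? (map f ys) ≡ count (P? ∘ f) ys
  count-map P? f []       = refl
  count-map P? f (y ∷ ys) = begin
    count P? (map f (y ∷ ys))             ≡⟨ count-∷ P? (f y) (map f ys) ⟩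
    ind (P? (f y)) + count P? (map f ys)  ≡⟨ cong (ind (P? (f y)) +_) (count-map P? f ys) ⟩
    ind (P? (f y)) + count (P? ∘ f) ys    ≡⟨ count-∷ (P? ∘ f) y ys ⟨
    count (P? ∘ f) (y ∷ ys)               ∎
    where open ≡-Reasoning

  count-none : {P : A → Set} (P? : Decidable P) → (∀ x → ¬ P x) → ∀ xs → count P? xs ≡ 0
  count-none P? ¬P xs = cong length (filter-none P? (universal ¬P xs))

  count-all : {P : A → Set} (P? : Decidable P) → (∀ x → P x) → ∀ xs → count P? xs ≡ length xs
  count-all P? allP xs = cong length (filter-all P? (universal allP xs))

  count-cong : {P Q : A → Set} (P? : Decidable P) (Q? : Decidable Q) → P ≐ Q →
    ∀ xs → count P? xs ≡ count Q? xs
  count-cong P? Q? P≐Q xs = cong length (filter-≐ P? Q? P≐Q xs)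

  count-congᴬ : {P Q : A → Set} (P? : Decidable P) (Q? : Decidable Q) → ∀ {xs} →
    All (λ x → (P x → Q x) × (Q x → P x)) xs → count P? xs ≡ count Q? xs
  count-congᴬ P? Q? []                      = refl
  count-congᴬ P? Q? {x ∷ xs} ((f , g) ∷ fgs) with P? x | Q? x
  ... | yes _ | yes _ = cong suc (count-congᴬ P? Q? fgs)
  ... | no _  | no _  = count-congᴬ P? Q? fgs
  ... | yes p | no ¬q = ⊥-elim (¬q (f p))
  ... | no ¬p | yes q = ⊥-elim (¬p (g q))

  filter-map : {P : A → Set} (P? : Decidable P) (f : B → A) → ∀ xs →
    filter P? (map f xs) ≡ map f (filter (P? ∘ f) xs)
  filter-map P? f []       = refl
  filter-map P? f (x ∷ xs) with P? (f x)
  ... | yes _ = cong (f x ∷_) (filter-map P? f xs)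
  ... | no _  = filter-map P? f xs

  count-filter : {P R : A → Set} (P? : Decidable P) (R? : Decidable R) → (∀ x → P x → R x) →
    ∀ xs → count P? (filter R? xs) ≡ count P? xs
  count-filter P? R? P⇒R []       = refl
  count-filter P? R? P⇒R (x ∷ xs) with R? x
  ... | yes _ = trans (count-∷ P? x (filter R? xs)) (trans (cong (ind (P? x) +_) (count-filter P? R? P⇒R xs))
                  (sym (count-∷ P? x xs)))
  ... | no ¬r = trans (count-filter P? R? P⇒R xs) (sym (count-no P? xs (¬r ∘ P⇒R x)))

  count-witness : {P : A → Set} (P? : Decidable P) → ∀ xs → 0 < count P? xs → ∃ P
  count-witness P? (x ∷ xs) pos with P? x
  ... | yes p = x , p
  ... | no _  = count-witness P? xs pos

  +-interchange : ∀ a b c d → (a + b) + (c + d) ≡ (a + c) + (b + d)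
  +-interchange a b c d = begin
    (a + b) + (c + d) ≡⟨ +-assoc a b (c + d) ⟩
    a + (b + (c + d)) ≡⟨ cong (a +_) (+-assoc b c d) ⟨
    a + ((b + c) + d) ≡⟨ cong (λ z → a + (z + d)) (+-comm b c) ⟩
    a + ((c + b) + d) ≡⟨ cong (a +_) (+-assoc c b d) ⟩
    a + (c + (b + d)) ≡⟨ +-assoc a c (b + d) ⟨
    (a + c) + (b + d) ∎
    where open ≡-Reasoning

  sum-map-+ : (f g : A → ℕ) → ∀ xs → sum (map (λ x → f x + g x) xs) ≡ sum (map f xs) + sum (map g xs)
  sum-map-+ f g []       = refl
  sum-map-+ f g (x ∷ xs) =
    trans (cong (f x + g x +_) (sum-map-+ f g xs)) (+-interchange (f x) (g x) _ _)

  sum-const : (c : ℕ) → ∀ (xs : List A) → sum (map (λ _ → c) xs) ≡ length xs * c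
  sum-const c []       = refl
  sum-const c (x ∷ xs) = cong (c +_) (sum-const c xs)

  sum-*ˡ : (c : ℕ) (f : A → ℕ) → ∀ xs → sum (map (λ x → c * f x) xs) ≡ c * sum (map f xs)
  sum-*ˡ c f []       = sym (*-zeroʳ c)
  sum-*ˡ c f (x ∷ xs) = trans (cong (c * f x +_) (sum-*ˡ c f xs)) (sym (*-distribˡ-+ c (f x) _))

  sum-ind-* : {X : A → Set} (X? : Decidable X) (c : ℕ) → ∀ xs →
    sum (map (λ x → ind (X? x) * c) xs) ≡ count X? xs * c
  sum-ind-* X? c []       = refl
  sum-ind-* X? c (x ∷ xs) = begin
    ind (X? x) * c + sum (map (λ x → ind (X? x) * c) xs) ≡⟨ cong (ind (X? x) * c +_) (sum-ind-* X? c xs) ⟩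
    ind (X? x) * c + count X? xs * c                      ≡⟨ *-distribʳ-+ c (ind (X? x)) (count X? xs) ⟨
    (ind (X? x) + count X? xs) * c                        ≡⟨ cong (_* c) (count-∷ X? x xs) ⟨
    count X? (x ∷ xs) * c                                 ∎
    where open ≡-Reasoning

  count-⊎ : {P R T : A → Set} (P? : Decidable P) (R? : Decidable R) (T? : Decidable T) →
    (∀ x → T x → P x ⊎ R x) → (∀ x → P x ⊎ R x → T x) → (∀ x → P x → ¬ R x) →
    ∀ xs → count T? xs ≡ count P? xs + count R? xs
  count-⊎ P? R? T? T⇒ ⇒T disjoint []       = refl
  count-⊎ P? R? T? T⇒ ⇒T disjoint (x ∷ xs) = begin
    count T? (x ∷ xs)                                    ≡⟨ count-∷ T? x xs ⟩
    ind (T? x) + count T? xs                             ≡⟨ cong₂ _+_ (ind-⊎ (P? x) (R? x) (T? x))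
                                                                       (count-⊎ P? R? T? T⇒ ⇒T disjoint xs) ⟩
    (ind (P? x) + ind (R? x)) + (count P? xs + count R? xs) ≡⟨ +-interchange (ind (P? x)) (ind (R? x)) _ _ ⟩
    (ind (P? x) + count P? xs) + (ind (R? x) + count R? xs) ≡⟨ cong₂ _+_ (count-∷ P? x xs) (count-∷ R? x xs) ⟨
    count P? (x ∷ xs) + count R? (x ∷ xs)                ∎
    where
    open ≡-Reasoning
    ind-⊎ : (p : Dec _) (r : Dec _) (t : Dec _) → ind t ≡ ind p + ind r
    ind-⊎ (yes p) (yes r) _       = ⊥-elim (disjoint x p r)
    ind-⊎ (yes p) (no _)  (yes _) = refl
    ind-⊎ (no _)  (yes r) (yes _) = refl
    ind-⊎ (no _)  (no _)  (no _)  = refl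
    ind-⊎ (yes p) (no _)  (no ¬t) = ⊥-elim (¬t (⇒T x (inj₁ p)))
    ind-⊎ (no _)  (yes r) (no ¬t) = ⊥-elim (¬t (⇒T x (inj₂ r)))
    ind-⊎ (no ¬p) (no ¬r) (yes t) with T⇒ x t
    ... | inj₁ p = ⊥-elim (¬p p)
    ... | inj₂ r = ⊥-elim (¬r r)

  double-count : {Q : A → B → Set} (Q? : ∀ a → Decidable (Q a)) → ∀ as bs →
    sum (map (λ a → count (Q? a) bs) as) ≡ sum (map (λ b → count (λ a → Q? a b) as) bs)
  double-count Q? []       bs = trans (sym (*-zeroʳ (length bs))) (sym (sum-const 0 bs))
  double-count Q? (a ∷ as) bs = begin
    count (Q? a) bs + sum (map (λ a → count (Q? a) bs) as)
      ≡⟨ cong₂ _+_ (count-by-ind bs) (double-count Q? as bs) ⟩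
    sum (map (ind ∘ Q? a) bs) + sum (map (λ b → count (λ a → Q? a b) as) bs)
      ≡⟨ sum-map-+ (ind ∘ Q? a) (λ b → count (λ a → Q? a b) as) bs ⟨
    sum (map (λ b → ind (Q? a b) + count (λ a → Q? a b) as) bs)
      ≡⟨ cong sum (map-cong (λ b → sym (count-∷ (λ a → Q? a b) a as)) bs) ⟩
    sum (map (λ b → count (λ a → Q? a b) (a ∷ as)) bs) ∎
    where
    open ≡-Reasoning
    count-by-ind : ∀ bs → count (Q? a) bs ≡ sum (map (ind ∘ Q? a) bs)
    count-by-ind []       = refl
    count-by-ind (b ∷ bs) = trans (count-∷ (Q? a) b bs) (cong (ind (Q? a b) +_) (count-by-ind bs))

  count-guarded : {X : Set} {Q : A → Set} (X? : Dec X) (Q? : Decidable Q) {c : ℕ} →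
    (∀ y → Q y → X) → ∀ ys → (X → count Q? ys ≡ c) → count Q? ys ≡ ind X? * c
  count-guarded (yes x) Q? {c} _ ys h = trans (h x) (sym (+-identityʳ c))
  count-guarded (no ¬x) Q? toX ys _ = count-none Q? (λ y q → ¬x (toX y q)) ys

  count-allVecs-suc : ∀ {k} {P : Vec A (suc k) → Set} (P? : Decidable P) (L : List A) →
    count P? (allVecs L (suc k)) ≡ sum (map (λ x → count (P? ∘ (x ∷_)) (allVecs L k)) L)
  count-allVecs-suc {k = k} P? L = trans (count-concatMap P? (λ x → map (x ∷_) (allVecs L k)) L)
    (cong sum (map-cong (λ x → count-map P? (x ∷_) (allVecs L k)) L))

  count-allVecs : (L : List A) (k : ℕ) {Q : Fin k → A → Set} (Q? : ∀ j → Decidable (Q j))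
    {P : Vec A k → Set} (P? : Decidable P) →
    (∀ v → P v → ∀ j → Q j (lookup v j)) → (∀ v → (∀ j → Q j (lookup v j)) → P v) →
    count P? (allVecs L k) ≡ ∏ (λ j → count (Q? j) L)
  count-allVecs L zero Q? P? _ fromQ = count-yes P? [] (fromQ [] (λ ()))
  count-allVecs L (suc k) Q? P? toQ fromQ = begin
    count P? (allVecs L (suc k))
      ≡⟨ count-allVecs-suc P? L ⟩
    sum (map (λ x → count (P? ∘ (x ∷_)) (allVecs L k)) L)
      ≡⟨ cong sum (map-cong row L) ⟩
    sum (map (λ x → ind (Q? zero x) * rest) L)
      ≡⟨ sum-ind-* (Q? zero) rest L ⟩
    count (Q? zero) L * rest ∎
    where
    open ≡-Reasoning
    rest = ∏ (λ j → count (Q? (suc j)) L)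
    row : ∀ x → count (P? ∘ (x ∷_)) (allVecs L k) ≡ ind (Q? zero x) * rest
    row x = count-guarded (Q? zero x) (P? ∘ (x ∷_)) (λ v p → toQ (x ∷ v) p zero) (allVecs L k)
      (λ q → count-allVecs L k (Q? ∘ suc) (P? ∘ (x ∷_)) (λ v p j → toQ (x ∷ v) p (suc j))
               (λ v h → fromQ (x ∷ v) λ { zero → q ; (suc j) → h j }))

  cartesianProduct-concatMap : (xs : List A) (ys : List B) →
    cartesianProduct xs ys ≡ concatMap (λ x → map (x ,_) ys) xs
  cartesianProduct-concatMap []       ys = refl
  cartesianProduct-concatMap (x ∷ xs) ys = cong (map (x ,_) ys ++_) (cartesianProduct-concatMap xs ys)

  count-cartesianProduct : {Q : A × B → Set} {X : A → Set} {Y : B → Set}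
    (Q? : Decidable Q) (X? : Decidable X) (Y? : Decidable Y) →
    (∀ a b → Q (a , b) → X a × Y b) → (∀ a b → X a → Y b → Q (a , b)) → ∀ xs ys →
    count Q? (cartesianProduct xs ys) ≡ count X? xs * count Y? ys
  count-cartesianProduct Q? X? Y? toXY fromXY xs ys = begin
    count Q? (cartesianProduct xs ys)
      ≡⟨ cong (count Q?) (cartesianProduct-concatMap xs ys) ⟩
    count Q? (concatMap (λ x → map (x ,_) ys) xs)
      ≡⟨ count-concatMap Q? (λ x → map (x ,_) ys) xs ⟩
    sum (map (λ x → count Q? (map (x ,_) ys)) xs)
      ≡⟨ cong sum (map-cong row xs) ⟩
    sum (map (λ x → ind (X? x) * count Y? ys) xs)
      ≡⟨ sum-ind-* X? (count Y? ys) xs ⟩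
    count X? xs * count Y? ys ∎
    where
    open ≡-Reasoning
    row : ∀ x → count Q? (map (x ,_) ys) ≡ ind (X? x) * count Y? ys
    row x = trans (count-map Q? (x ,_) ys)
      (count-guarded (X? x) (Q? ∘ (x ,_)) (λ b q → proj₁ (toXY x b q)) ys
        (λ xx → count-cong (Q? ∘ (x ,_)) Y? ((λ q → proj₂ (toXY x _ q)) , fromXY x _ xx) ys))

  length-allVecs : (L : List A) (k : ℕ) → length (allVecs L k) ≡ length L ^ k
  length-allVecs L k = begin
    length (allVecs L k)              ≡⟨ count-all (λ _ → yes tt) (λ _ → tt) (allVecs L k) ⟨
    count (λ _ → yes tt) (allVecs L k) ≡⟨ count-allVecs L k (λ _ _ → yes tt) (λ _ → yes tt) (λ _ _ _ → tt) (λ _ _ → tt) ⟩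
    ∏ (λ (_ : Fin k) → count (λ (_ : _) → yes tt) L) ≡⟨ ∏-const k ⟩
    length L ^ k                      ∎
    where
    open ≡-Reasoning
    ∏-const : ∀ k → ∏ (λ (_ : Fin k) → count (λ (_ : _) → yes tt) L) ≡ length L ^ k
    ∏-const zero    = refl
    ∏-const (suc k) = cong₂ _*_ (count-all (λ _ → yes tt) (λ _ → tt) L) (∏-const k)

module FinProducts where

  open import Data.Nat using (zero; suc; _*_; _∸_; _!)
  open import Data.Nat.Properties using (*-1-commutativeMonoid; +-0-commutativeMonoid; <-irrefl)
  open import Data.List using (map; foldr; allFin; tabulate)
  open import Algebra.Bundles using (CommutativeMonoid)
  open import Level using (0ℓ)
  open import Data.List.Properties using (map-tabulate)
  open import Data.Fin using (Fin; zero; suc; toℕ; punchOut)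
  open import Data.Fin.Properties using (any?; punchOut-injective; injective⇒≤) renaming (_≟_ to _≟ᶠ_)
  open import Data.Fin.Permutation using (Permutation; permutation)
  open import Data.Product using (∃; _,_; proj₁; proj₂)
  open import Data.Empty using (⊥-elim)
  open import Relation.Binary.PropositionalEquality using (_≡_; _≢_; refl; sym; trans; cong)
  open import Relation.Nullary using (yes; no)
  open import Function using (_∘_; id)
  open import Function.Definitions using (Injective)
  open Counting using (∏)

  injective⇒surjective : ∀ {n} (f : Fin n → Fin n) → Injective _≡_ _≡_ f → ∀ y → ∃ λ x → f x ≡ y
  injective⇒surjective {suc n} f inj y with any? (λ x → f x ≟ᶠ y)
  ... | yes hit = hit
  ... | no miss = ⊥-elim (<-irrefl refl (injective⇒≤ squeeze-injective))
    where
    missed : ∀ x → y ≢ f x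
    missed x eq = miss (x , sym eq)
    squeeze : Fin (suc n) → Fin n
    squeeze x = punchOut (missed x)
    squeeze-injective : Injective _≡_ _≡_ squeeze
    squeeze-injective {x} {x'} = inj ∘ punchOut-injective (missed x) (missed x')

  injective⇒permutation : ∀ {n} (f : Fin n → Fin n) → Injective _≡_ _≡_ f → Permutation n n
  injective⇒permutation f inj = permutation f (proj₁ ∘ surj) (proj₂ ∘ surj) (λ x → inj (proj₂ (surj (f x))))
    where surj = injective⇒surjective f inj

  module FinFold (M : CommutativeMonoid 0ℓ 0ℓ) where
    open CommutativeMonoid M using (Carrier; _≈_; _∙_; ε)
    open import Algebra.Properties.CommutativeMonoid.Sum M using (sum; sum-permute)

    sum-reindex : ∀ {n} (f : Fin n → Fin n) → Injective _≡_ _≡_ f → (g : Fin n → Carrier) → sum g ≈ sum (g ∘ f)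
    sum-reindex f inj g = sum-permute g (injective⇒permutation f inj)

    foldr-allFin : ∀ n (g : Fin n → Carrier) → foldr _∙_ ε (map g (allFin n)) ≡ sum g
    foldr-allFin n g = trans (cong (foldr _∙_ ε) (map-tabulate id g)) (foldr-tabulate n g)
      where
      foldr-tabulate : ∀ n (g : Fin n → Carrier) → foldr _∙_ ε (tabulate g) ≡ sum g
      foldr-tabulate zero    g = refl
      foldr-tabulate (suc n) g = cong (g zero ∙_) (foldr-tabulate n (g ∘ suc))

  open FinFold *-1-commutativeMonoid public
    using () renaming (sum-reindex to ∏-reindex; foldr-allFin to product-allFin)
  open FinFold +-0-commutativeMonoid public
    using () renaming (sum-reindex to ∑-reindex; foldr-allFin to sum-allFin)

  ∏-factorial : ∀ n → ∏ (λ (p : Fin n) → n ∸ toℕ p) ≡ n !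
  ∏-factorial zero    = refl
  ∏-factorial (suc n) = cong (suc n *_) (∏-factorial n)

module NatCounting where

  open import Defs using (count)
  open Counting
  open import Data.Nat using (ℕ; zero; suc; _+_; _∸_; _⊔_; _≤_; _≤?_)
  open import Data.Nat.Properties
  open import Data.List using (List; []; _∷_; [_]; _∷ʳ_; map; filter; length; foldr; upTo; applyUpTo; allFin; tabulate)
  open import Data.List.Properties using (upTo-∷ʳ; map-upTo; map-tabulate; map-++; filter-accept; filter-none; length-map)
  open import Data.List.Relation.Unary.All using (universal)
  import Data.List.Relation.Unary.All as All
  open import Data.List.Relation.Unary.All.Properties using (all-upTo; map⁺)
  open import Data.Fin using (toℕ)
  open import Data.Product using (_×_; _,_; proj₂)
  open import Relation.Binary.PropositionalEquality using (_≡_; refl; sym; trans; cong; cong₂; module ≡-Reasoning)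
  open import Relation.Nullary using (Dec; yes; no; ¬_)
  open import Relation.Nullary.Decidable using (_×-dec_)
  open import Relation.Unary using (Decidable)
  open import Data.Empty using ()
  open import Function using (_∘_; id)

  upTo-suc-∷ : ∀ m → upTo (suc m) ≡ 0 ∷ map suc (upTo m)
  upTo-suc-∷ m = cong (0 ∷_) (sym (map-upTo suc m))

  upTo-suc-∷ʳ : ∀ m → upTo (suc m) ≡ upTo m ∷ʳ m
  upTo-suc-∷ʳ m = sym (upTo-∷ʳ m)

  count-toℕ : ∀ n {X : ℕ → Set} (X? : Decidable X) → count (X? ∘ toℕ) (allFin n) ≡ count X? (upTo n)
  count-toℕ n X? = begin
    count (X? ∘ toℕ) (allFin n)   ≡⟨ count-map X? toℕ (allFin n) ⟨
    count X? (map toℕ (allFin n)) ≡⟨ cong (count X?) (trans (map-tabulate id toℕ) (tabulate-toℕ n id)) ⟩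
    count X? (upTo n)             ∎
    where
    open ≡-Reasoning
    tabulate-toℕ : ∀ n {A : Set} (f : ℕ → A) → tabulate {n = n} (f ∘ toℕ) ≡ applyUpTo f n
    tabulate-toℕ zero    f = refl
    tabulate-toℕ (suc n) f = cong (f 0 ∷_) (tabulate-toℕ n (f ∘ suc))

  count-reflect : ∀ {X : ℕ → Set} (X? : Decidable X) m →
    count (λ c → X? (m ∸ c)) (upTo m) ≡ count X? (map suc (upTo m))
  count-reflect X? zero    = refl
  count-reflect X? (suc m) = begin
    count (λ c → X? (suc m ∸ c)) (upTo (suc m))
      ≡⟨ cong (count (λ c → X? (suc m ∸ c))) (upTo-suc-∷ m) ⟩
    count (λ c → X? (suc m ∸ c)) (0 ∷ map suc (upTo m))
      ≡⟨ count-∷ (λ c → X? (suc m ∸ c)) 0 (map suc (upTo m)) ⟩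
    ind (X? (suc m)) + count (λ c → X? (suc m ∸ c)) (map suc (upTo m))
      ≡⟨ cong (ind (X? (suc m)) +_) (count-map (λ c → X? (suc m ∸ c)) suc (upTo m)) ⟩
    ind (X? (suc m)) + count (λ c → X? (m ∸ c)) (upTo m)
      ≡⟨ cong (ind (X? (suc m)) +_) (count-reflect X? m) ⟩
    ind (X? (suc m)) + count X? (map suc (upTo m))
      ≡⟨ +-comm (ind (X? (suc m))) _ ⟩
    count X? (map suc (upTo m)) + ind (X? (suc m))
      ≡⟨ count-∷ʳ X? (map suc (upTo m)) (suc m) ⟨
    count X? (map suc (upTo m) ∷ʳ suc m)
      ≡⟨ cong (count X?) (sym (map-++ suc (upTo m) [ m ])) ⟩
    count X? (map suc (upTo m ∷ʳ m))
      ≡⟨ cong (count X? ∘ map suc) (upTo-suc-∷ʳ m) ⟨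
    count X? (map suc (upTo (suc m))) ∎
    where open ≡-Reasoning

  count-restrict : ∀ {X : ℕ → Set} (X? : Decidable X) m d →
    count (λ c → (c ≤? m) ×-dec X? c) (upTo (suc m + d)) ≡ count X? (upTo (suc m))
  count-restrict X? m zero = trans
    (cong (count (λ c → (c ≤? m) ×-dec X? c) ∘ upTo) (+-identityʳ (suc m)))
    (count-congᴬ (λ c → (c ≤? m) ×-dec X? c) X? (All.map (λ c<m → proj₂ , (≤-pred c<m ,_)) (all-upTo (suc m))))
  count-restrict X? m (suc d) = begin
    count Q? (upTo (suc m + suc d))      ≡⟨ cong (count Q? ∘ upTo) (+-suc (suc m) d) ⟩
    count Q? (upTo (suc (suc m + d)))    ≡⟨ cong (count Q?) (upTo-suc-∷ʳ (suc m + d)) ⟩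
    count Q? (upTo (suc m + d) ∷ʳ (suc m + d))
      ≡⟨ count-∷ʳ Q? (upTo (suc m + d)) (suc m + d) ⟩
    count Q? (upTo (suc m + d)) + ind (Q? (suc m + d))
      ≡⟨ cong₂ _+_ (count-restrict X? m d) (ind-no (Q? (suc m + d)) out-of-range) ⟩
    count X? (upTo (suc m)) + 0          ≡⟨ +-identityʳ _ ⟩
    count X? (upTo (suc m))              ∎
    where
    open ≡-Reasoning
    Q? = λ c → (c ≤? m) ×-dec X? c
    out-of-range : ¬ (suc m + d ≤ m × _)
    out-of-range (le , _) = <-irrefl refl (≤-trans (m≤m+n (suc m) d) le)

  count-≥ : ∀ m n → count (m ≤?_) (upTo n) ≡ n ∸ m
  count-≥ m zero    = sym (0∸n≡0 m)
  count-≥ m (suc n) = begin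
    count (m ≤?_) (upTo (suc n))          ≡⟨ cong (count (m ≤?_)) (upTo-suc-∷ʳ n) ⟩
    count (m ≤?_) (upTo n ∷ʳ n)           ≡⟨ count-∷ʳ (m ≤?_) (upTo n) n ⟩
    count (m ≤?_) (upTo n) + ind (m ≤? n) ≡⟨ cong (_+ ind (m ≤? n)) (count-≥ m n) ⟩
    n ∸ m + ind (m ≤? n)                  ≡⟨ last-step (m ≤? n) ⟩
    suc n ∸ m                             ∎
    where
    open ≡-Reasoning
    last-step : (d : Dec (m ≤ n)) → n ∸ m + ind d ≡ suc n ∸ m
    last-step (yes m≤n) = trans (+-comm (n ∸ m) 1) (sym (+-∸-assoc 1 m≤n))
    last-step (no m≰n)  = trans (+-identityʳ _)
      (trans (m≤n⇒m∸n≡0 (<⇒≤ (≰⇒> m≰n))) (sym (m≤n⇒m∸n≡0 (≰⇒> m≰n))))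

  maximum : List ℕ → ℕ
  maximum = foldr _⊔_ 0

  -- Shifting a list by one shifts its maximum (1 ⊔ accounts for the empty list).
  maximum-map-suc : ∀ xs → 1 ⊔ maximum (map suc xs) ≡ suc (maximum xs)
  maximum-map-suc []       = refl
  maximum-map-suc (x ∷ xs) = begin
    1 ⊔ (suc x ⊔ rest) ≡⟨ ⊔-assoc 1 (suc x) rest ⟨
    (1 ⊔ suc x) ⊔ rest ≡⟨ cong (_⊔ rest) (⊔-comm 1 (suc x)) ⟩
    (suc x ⊔ 1) ⊔ rest ≡⟨ ⊔-assoc (suc x) 1 rest ⟩
    suc x ⊔ (1 ⊔ rest) ≡⟨ cong (suc x ⊔_) (maximum-map-suc xs) ⟩
    suc (x ⊔ maximum xs) ∎
    where
    open ≡-Reasoning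
    rest = maximum (map suc xs)

  maximum-downward : ∀ {W : ℕ → Set} (W? : Decidable W) → (∀ j → W (suc (suc j)) → W (suc j)) →
    ∀ m → maximum (filter W? (map suc (upTo m))) ≡ count W? (map suc (upTo m))
  maximum-downward W? down zero    = refl
  maximum-downward {W} W? down (suc m) = begin
    maximum (filter W? (map suc (upTo (suc m)))) ≡⟨ cong (maximum ∘ filter W? ∘ map suc) (upTo-suc-∷ m) ⟩
    maximum (filter W? (1 ∷ S))                  ≡⟨ from-1 (W? 1) ⟩
    count W? (1 ∷ S)                             ≡⟨ cong (count W? ∘ map suc) (upTo-suc-∷ m) ⟨
    count W? (map suc (upTo (suc m)))            ∎
    where
    open ≡-Reasoning
    S = map suc (map suc (upTo m))
    F = filter (W? ∘ suc) (map suc (upTo m))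
    shifted : filter W? S ≡ map suc F
    shifted = filter-map W? suc (map suc (upTo m))
    ¬W : ¬ W 1 → ∀ j → ¬ W (suc j)
    ¬W ¬W1 zero    = ¬W1
    ¬W ¬W1 (suc j) = ¬W ¬W1 j ∘ down j
    from-1 : Dec (W 1) → maximum (filter W? (1 ∷ S)) ≡ count W? (1 ∷ S)
    from-1 (yes W1) = begin
      maximum (filter W? (1 ∷ S))  ≡⟨ cong maximum (filter-accept W? W1) ⟩
      1 ⊔ maximum (filter W? S)    ≡⟨ cong (λ L → 1 ⊔ maximum L) shifted ⟩
      1 ⊔ maximum (map suc F)      ≡⟨ maximum-map-suc F ⟩
      suc (maximum F)              ≡⟨ cong suc (maximum-downward (W? ∘ suc) (down ∘ suc) m) ⟩
      suc (length F)               ≡⟨ cong suc (length-map suc F) ⟨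
      suc (length (map suc F))     ≡⟨ cong (suc ∘ length) shifted ⟨
      suc (count W? S)             ≡⟨ count-yes W? S W1 ⟨
      count W? (1 ∷ S)             ∎
    from-1 (no ¬W1) = trans (cong maximum nothing) (sym (cong length nothing))
      where
      nothing : filter W? (1 ∷ S) ≡ []
      nothing = filter-none W? (map⁺ (universal (¬W ¬W1) (0 ∷ map suc (upTo m))))

module Membership where

  open import Defs using (upper; interval)
  open import Data.Bool using (Bool; true; _∧_)
  open import Data.Bool.Properties using (∧-conicalˡ; ∧-conicalʳ)
  open import Data.Vec using (tabulate)
  open import Data.Vec.Properties using ([]=⇒lookup; lookup⇒[]=; lookup∘tabulate)
  open import Data.Fin using (Fin; _≤_)
  open import Data.Fin.Properties using (_≤?_)
  open import Data.Fin.Subset using (_∈_)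
  open import Data.Product using (_×_; _,_)
  open import Relation.Binary.PropositionalEquality using (_≡_; trans; sym; cong₂)
  open import Relation.Nullary using (Dec; yes; no; does)
  open import Relation.Nullary.Decidable using (dec-true)

  does-true : ∀ {P : Set} (d : Dec P) → does d ≡ true → P
  does-true (yes p) _ = p
  does-true (no _) ()

  module _ {n} {b : Fin n → Bool} {k : Fin n} where

    ∈-tabulate⁻ : k ∈ tabulate b → b k ≡ true
    ∈-tabulate⁻ k∈ = trans (sym (lookup∘tabulate b k)) ([]=⇒lookup k∈)

    ∈-tabulate⁺ : b k ≡ true → k ∈ tabulate b
    ∈-tabulate⁺ bk = lookup⇒[]= k (tabulate b) (trans (lookup∘tabulate b k) bk)

  module _ {n} {c k : Fin n} where

    ∈upper⁻ : k ∈ upper c → c ≤ k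
    ∈upper⁻ k∈ = does-true (c ≤? k) (∈-tabulate⁻ k∈)

    ∈upper⁺ : c ≤ k → k ∈ upper c
    ∈upper⁺ c≤k = ∈-tabulate⁺ (dec-true (c ≤? k) c≤k)

  module _ {n} {x y k : Fin n} where

    ∈interval⁻ : k ∈ interval x y → x ≤ k × k ≤ y
    ∈interval⁻ k∈ = does-true (x ≤? k) (∧-conicalˡ _ _ both) , does-true (k ≤? y) (∧-conicalʳ _ _ both)
      where both = ∈-tabulate⁻ k∈

    ∈interval⁺ : x ≤ k → k ≤ y → k ∈ interval x y
    ∈interval⁺ x≤k k≤y = ∈-tabulate⁺ (cong₂ _∧_ (dec-true (x ≤? k) x≤k) (dec-true (k ≤? y) k≤y))

module PerPermutation where

  open import Defs
  open Counting
  open NatCounting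
  open Membership
  open FinProducts
  open import Data.Nat using (suc; _+_; _*_; _∸_; _≤_; _!) renaming (_≤?_ to _≤ℕ?_)
  open import Data.Nat.Properties
  open import Data.List using (map; upTo; allFin; cartesianProduct)
  open import Data.Vec using (Vec; lookup)
  import Data.Vec as Vec
  open import Data.Vec.Properties using (lookup-map)
  open import Data.Fin using (Fin; toℕ) renaming (_≤_ to _≤ᶠ_; _<_ to _<ᶠ_)
  open import Data.Fin.Properties using (all?; toℕ-injective; toℕ<n)
    renaming (_≟_ to _≟ᶠ_; _≤?_ to _≤ᶠ?_; _<?_ to _<ᶠ?_)
  open import Data.Fin.Subset using (Subset; _∈_)
  open import Data.Fin.Subset.Properties using (_∈?_)
  open import Data.Product using (_×_; _,_; proj₁; proj₂)
  open import Relation.Binary.PropositionalEquality using (_≡_; refl; sym; trans; cong; cong₂; subst; module ≡-Reasoning)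
  open import Relation.Nullary using (Dec; yes; no; ¬_)
  open import Relation.Nullary.Decidable using (_×-dec_; _→-dec_; ¬?)
  open import Data.Empty using (⊥-elim)
  open import Function using (_∘_)
  open import Algebra.Properties.CommutativeMonoid.Sum *-1-commutativeMonoid
    using (∑-distrib-+; sum-cong-≗)

  module _ {n} (π : Vec (Fin n) n) where

    CarOK : Fin n → Subset n → Set
    CarOK i S = ∀ p → lookup π p ≡ i → IsMin (λ k → k ∈ S × ¬ Taken π i k) p

    carOK? : ∀ i S → Dec (CarOK i S)
    carOK? i S = all? (λ p → (lookup π p ≟ᶠ i) →-dec
      (((p ∈? S) ×-dec ¬? (taken? π i p)) ×-dec
        all? (λ k → ((k ∈? S) ×-dec ¬? (taken? π i k)) →-dec (p ≤ᶠ? k))))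

    outcome⇒carOK : ∀ {X : Set} (f : X → Subset n) (v : Vec X n) →
      Outcome π (Vec.map f v) → ∀ i → CarOK i (f (lookup v i))
    outcome⇒carOK f v O i = subst (CarOK i) (lookup-map i f v) (O i)

    carOK⇒outcome : ∀ {X : Set} (f : X → Subset n) (v : Vec X n) →
      (∀ i → CarOK i (f (lookup v i))) → Outcome π (Vec.map f v)
    carOK⇒outcome f v ok i = subst (CarOK i) (sym (lookup-map i f v)) (ok i)

    taken⇒ : ∀ {i k} → Taken π i k → lookup π k <ᶠ i
    taken⇒ (_ , lt , refl) = lt

    ⇒taken : ∀ {i k} → lookup π k <ᶠ i → Taken π i k
    ⇒taken lt = _ , lt , refl

  module _ {n} (π : Vec (Fin n) n) (π-inj : IsPerm π) where

    πₚ : Fin n → Fin n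
    πₚ = lookup π

    -- Car πₚ p, with preference set S, parks at p iff p ∈ S and every spot of S
    -- to the left of p is already occupied by a car with a smaller label.
    ParksAt : Fin n → Subset n → Set
    ParksAt p S = p ∈ S × (∀ k → k ∈ S → k <ᶠ p → πₚ k <ᶠ πₚ p)

    carOK⇒parksAt : ∀ p S → CarOK π (πₚ p) S → ParksAt p S
    carOK⇒parksAt p S ok = p∈S , earlier
      where
      p∈S = proj₁ (proj₁ (ok p refl))
      leftmost = proj₂ (ok p refl)
      earlier : ∀ k → k ∈ S → k <ᶠ p → πₚ k <ᶠ πₚ p
      earlier k k∈S k<p with πₚ k <ᶠ? πₚ p
      ... | yes lt = lt
      ... | no ¬lt = ⊥-elim (<⇒≱ k<p (leftmost k (k∈S , ¬lt ∘ taken⇒ π)))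

    parksAt⇒carOK : ∀ p S → ParksAt p S → CarOK π (πₚ p) S
    parksAt⇒carOK p S (p∈S , earlier) p' e with π-inj p' p e
    ... | refl = (p∈S , <-irrefl refl ∘ taken⇒ π) , leftmost
      where
      leftmost : ∀ k → k ∈ S × ¬ Taken π (πₚ p) k → p ≤ᶠ k
      leftmost k (k∈S , free) with k <ᶠ? p
      ... | yes k<p = ⊥-elim (free (⇒taken π (earlier k k∈S k<p)))
      ... | no ¬k<p = ≮⇒≥ ¬k<p

    Clear : Fin n → Fin n → Set
    Clear p c = ∀ k → c ≤ᶠ k → k <ᶠ p → πₚ k <ᶠ πₚ p

    parksAt-upper⁻ : ∀ p c → ParksAt p (upper c) → c ≤ᶠ p × Clear p c
    parksAt-upper⁻ p c (p∈ , earlier) = ∈upper⁻ p∈ , λ k c≤k → earlier k (∈upper⁺ c≤k)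

    parksAt-upper⁺ : ∀ p c → c ≤ᶠ p × Clear p c → ParksAt p (upper c)
    parksAt-upper⁺ p c (c≤p , clear) = ∈upper⁺ c≤p , λ k k∈ → clear k (∈upper⁻ k∈)

    parksAt-interval⁻ : ∀ p x y → ParksAt p (interval x y) → (x ≤ᶠ p × Clear p x) × p ≤ᶠ y
    parksAt-interval⁻ p x y (p∈ , earlier) =
      (x≤p , λ k x≤k k<p → earlier k (∈interval⁺ x≤k (≤-trans (<⇒≤ k<p) p≤y)) k<p) , p≤y
      where
      x≤p = proj₁ (∈interval⁻ {x = x} {y = y} p∈)
      p≤y = proj₂ (∈interval⁻ {x = x} {y = y} p∈)

    parksAt-interval⁺ : ∀ p x y → (x ≤ᶠ p × Clear p x) × p ≤ᶠ y → ParksAt p (interval x y)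
    parksAt-interval⁺ p x y ((x≤p , clear) , p≤y) =
      ∈interval⁺ x≤p p≤y , λ k k∈ → clear k (proj₁ (∈interval⁻ {x = x} {y = y} k∈))

    -- Clear p c says that the window of length p + 1 - c ending at p is a
    -- window in the definition of a_p(π).
    window⇒clear : ∀ p c → c ≤ᶠ p → WindowOK π p (suc (toℕ p) ∸ toℕ c) → Clear p c
    window⇒clear p c c≤p window k c≤k k<p =
      ≤∧≢⇒< (window k (subst (_≤ toℕ k) (sym reflected) c≤k) (<⇒≤ k<p))
            (λ e → <-irrefl (cong toℕ (π-inj k p (toℕ-injective e))) k<p)
      where reflected = m∸[m∸n]≡n (m≤n⇒m≤1+n c≤p)

    clear⇒window : ∀ p c → c ≤ᶠ p → Clear p c → WindowOK π p (suc (toℕ p) ∸ toℕ c)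
    clear⇒window p c c≤p clear q lo q≤p with toℕ q ≟ toℕ p
    ... | yes q≡p = ≤-reflexive (cong (toℕ ∘ πₚ) (toℕ-injective q≡p))
    ... | no  q≢p = <⇒≤ (clear q (subst (_≤ toℕ q) reflected lo) (≤∧≢⇒< q≤p q≢p))
      where reflected = m∸[m∸n]≡n (m≤n⇒m≤1+n c≤p)

    window-shrink : ∀ p j → WindowOK π p (suc (suc j)) → WindowOK π p (suc j)
    window-shrink p j window q lo = window q (≤-trans (∸-monoʳ-≤ (suc (toℕ p)) (n≤1+n (suc j))) lo)

    -- c can be the left end of the preference set [c, n] of the car parked at p.
    BlockStart : Fin n → Fin n → Set
    BlockStart p c = c ≤ᶠ p × WindowOK π p (suc (toℕ p) ∸ toℕ c)

    blockStart? : ∀ p c → Dec (BlockStart p c)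
    blockStart? p c = (c ≤ᶠ? p) ×-dec windowOK? π p (suc (toℕ p) ∸ toℕ c)

    -- There are exactly a_p(π) block starts: reflecting c ↦ p + 1 - c turns them
    -- into the window lengths, whose maximum a_p(π) equals their number.
    count-blockStart : ∀ p → count (blockStart? p) (allFin n) ≡ a π p
    count-blockStart p = begin
      count (blockStart? p) (allFin n)
        ≡⟨ count-toℕ n Start? ⟩
      count Start? (upTo n)
        ≡⟨ cong (count Start? ∘ upTo) (m+[n∸m]≡n (toℕ<n p)) ⟨
      count Start? (upTo (suc P + (n ∸ suc P)))
        ≡⟨ count-restrict (λ c → W? (suc P ∸ c)) P (n ∸ suc P) ⟩
      count (λ c → W? (suc P ∸ c)) (upTo (suc P))
        ≡⟨ count-reflect W? (suc P) ⟩
      count W? (map suc (upTo (suc P)))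
        ≡⟨ maximum-downward W? (window-shrink p) (suc P) ⟨
      a π p ∎
      where
      open ≡-Reasoning
      P = toℕ p
      W? = windowOK? π p
      Start? = λ c → (c ≤ℕ? P) ×-dec W? (suc P ∸ c)

    carOK-upper⁻ : ∀ p c → CarOK π (πₚ p) (upper c) → BlockStart p c
    carOK-upper⁻ p c ok with parksAt-upper⁻ p c (carOK⇒parksAt p (upper c) ok)
    ... | c≤p , clear = c≤p , clear⇒window p c c≤p clear

    carOK-upper⁺ : ∀ p c → BlockStart p c → CarOK π (πₚ p) (upper c)
    carOK-upper⁺ p c (c≤p , window) =
      parksAt⇒carOK p (upper c) (parksAt-upper⁺ p c (c≤p , window⇒clear p c c≤p window))

    carOK-interval⁻ : ∀ p x y → CarOK π (πₚ p) (interval x y) → BlockStart p x × p ≤ᶠ y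
    carOK-interval⁻ p x y ok with parksAt-interval⁻ p x y (carOK⇒parksAt p (interval x y) ok)
    ... | (x≤p , clear) , p≤y = (x≤p , clear⇒window p x x≤p clear) , p≤y

    carOK-interval⁺ : ∀ p x y → BlockStart p x → p ≤ᶠ y → CarOK π (πₚ p) (interval x y)
    carOK-interval⁺ p x y (x≤p , window) p≤y = parksAt⇒carOK p (interval x y)
      (parksAt-interval⁺ p x y ((x≤p , window⇒clear p x x≤p window) , p≤y))

    count-upper : ∀ p → count (λ c → carOK? π (πₚ p) (upper c)) (allFin n) ≡ a π p
    count-upper p = trans
      (count-cong (λ c → carOK? π (πₚ p) (upper c)) (blockStart? p)
        (carOK-upper⁻ p _ , carOK-upper⁺ p _) (allFin n))
      (count-blockStart p)

    -- Number of intervals [x, y] with which car πₚ p parks at p: x ranges over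
    -- the block starts and y independently over [p, n].
    count-interval : ∀ p →
      count (λ xy → carOK? π (πₚ p) (interval (proj₁ xy) (proj₂ xy))) (intervals n) ≡ a π p * (n ∸ toℕ p)
    count-interval p = begin
      count Q? (intervals n)
        ≡⟨ count-filter Q? (λ xy → proj₁ xy ≤ᶠ? proj₂ xy) x≤y (cartesianProduct (allFin n) (allFin n)) ⟩
      count Q? (cartesianProduct (allFin n) (allFin n))
        ≡⟨ count-cartesianProduct Q? (blockStart? p) (p ≤ᶠ?_) (carOK-interval⁻ p) (carOK-interval⁺ p)
             (allFin n) (allFin n) ⟩
      count (blockStart? p) (allFin n) * count (p ≤ᶠ?_) (allFin n)
        ≡⟨ cong₂ _*_ (count-blockStart p) (trans (count-toℕ n (toℕ p ≤ℕ?_)) (count-≥ (toℕ p) n)) ⟩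
      a π p * (n ∸ toℕ p) ∎
      where
      open ≡-Reasoning
      Q? = λ (xy : Fin n × Fin n) → carOK? π (πₚ p) (interval (proj₁ xy) (proj₂ xy))
      x≤y : ∀ xy → CarOK π (πₚ p) (interval (proj₁ xy) (proj₂ xy)) → proj₁ xy ≤ᶠ proj₂ xy
      x≤y (x , y) ok with carOK-interval⁻ p x y ok
      ... | (x≤p , _) , p≤y = ≤-trans x≤p p≤y

    -- PF(n, π) = ∏_p a_p(π): the cars choose their upper sets independently.
    PF-prodA : PF n π ≡ prodA π
    PF-prodA = begin
      PF n π
        ≡⟨ count-allVecs (allFin n) n (λ i c → carOK? π i (upper c)) (λ c → outcome? π (toUppers c))
             (outcome⇒carOK π upper) (carOK⇒outcome π upper) ⟩
      ∏ (λ i → count (λ c → carOK? π i (upper c)) (allFin n))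
        ≡⟨ ∏-reindex πₚ (π-inj _ _) _ ⟩
      ∏ (λ p → count (λ c → carOK? π (πₚ p) (upper c)) (allFin n))
        ≡⟨ sum-cong-≗ count-upper ⟩
      ∏ (a π)
        ≡⟨ product-allFin n (a π) ⟨
      prodA π ∎
      where open ≡-Reasoning

    IPF-prodA : IPF n π ≡ prodA π * n !
    IPF-prodA = begin
      IPF n π
        ≡⟨ count-allVecs (intervals n) n (λ i xy → carOK? π i (toInterval xy)) (λ v → outcome? π (toIntervals v))
             (outcome⇒carOK π toInterval) (carOK⇒outcome π toInterval) ⟩
      ∏ (λ i → count (λ xy → carOK? π i (toInterval xy)) (intervals n))
        ≡⟨ ∏-reindex πₚ (π-inj _ _) _ ⟩
      ∏ (λ p → count (λ xy → carOK? π (πₚ p) (toInterval xy)) (intervals n))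
        ≡⟨ sum-cong-≗ count-interval ⟩
      ∏ (λ p → a π p * (n ∸ toℕ p))
        ≡⟨ ∑-distrib-+ {n} (a π) (λ p → n ∸ toℕ p) ⟩
      ∏ (a π) * ∏ (λ (p : Fin n) → n ∸ toℕ p)
        ≡⟨ cong₂ _*_ (sym (product-allFin n (a π))) (∏-factorial n) ⟩
      prodA π * n ! ∎
      where
      open ≡-Reasoning
      toInterval : Fin n × Fin n → Subset n
      toInterval (x , y) = interval x y

module Totals where

  open import Defs
  open Counting
  open import Data.Nat using (ℕ; zero; suc; _+_; _*_; _<_)
  open import Data.Nat.Properties using (≤-refl; ≤-antisym; m≤n⇒m<n∨m≡n; ≤-pred)
  open import Data.Nat.ListAction using (sum)
  open import Data.List using (List; []; _∷_; _++_; map; concatMap; allFin; cartesianProductWith)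
  open import Data.List.Properties using (map-cong-local)
  open import Data.List.Relation.Unary.Any using (Any; here; there; any?)
  open import Data.List.Relation.Unary.All using (All; []; _∷_)
  import Data.List.Relation.Unary.All as All
  open import Data.List.Relation.Unary.All.Properties using (all-filter)
  open import Data.List.Membership.Propositional using (_∈_; lose)
  open import Data.List.Membership.Propositional.Properties using (∈-allFin; ∈-filter⁺; ∈-map⁺; ∈-concatMap⁺)
  open import Data.List.Relation.Unary.AllPairs using ([]; _∷_)
  open import Data.List.Relation.Unary.Unique.Propositional using (Unique)
  open import Data.List.Relation.Unary.Unique.Propositional.Properties using (filter⁺; allFin⁺; cartesianProductWith⁺)
  open import Data.Vec using (Vec; []; _∷_; lookup)
  open import Data.Vec.Properties using (∷-injective; tabulate∘lookup; tabulate-cong)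
  open import Data.Fin using (Fin; toℕ) renaming (_<_ to _<ᶠ_)
  open import Data.Fin.Properties using (toℕ-injective)
  open import Data.Fin.Subset using (Subset)
  open import Data.Product using (_×_; _,_; proj₁; proj₂)
  open import Data.Sum using (inj₁; inj₂)
  open import Relation.Binary.PropositionalEquality using (_≡_; _≢_; refl; sym; trans; cong; subst; module ≡-Reasoning)
  open import Relation.Nullary using (¬_)
  open import Relation.Unary using (Decidable)
  open import Data.Empty using ()
  open import Function using (_∘_)
  open FinProducts using (injective⇒surjective)

  allVecs-unique : ∀ {A : Set} {xs : List A} → Unique xs → ∀ k → Unique (allVecs xs k)
  allVecs-unique u zero = [] ∷ []
  allVecs-unique {xs = xs} u (suc k) =
    subst Unique (sym (as-cartesianProduct xs)) (cartesianProductWith⁺ _∷_ ∷-injective u (allVecs-unique u k))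
    where
    as-cartesianProduct : ∀ ys → concatMap (λ y → map (y ∷_) (allVecs xs k)) ys
                               ≡ cartesianProductWith _∷_ ys (allVecs xs k)
    as-cartesianProduct []       = refl
    as-cartesianProduct (y ∷ ys) = cong (map (y ∷_) (allVecs xs k) ++_) (as-cartesianProduct ys)

  perms-unique : ∀ n → Unique (perms n)
  perms-unique n = filter⁺ isPerm? (allVecs-unique (allFin⁺ n) n)

  perms-all : ∀ n → All IsPerm (perms n)
  perms-all n = all-filter isPerm? (allVecs (allFin n) n)

  allVecs-complete : ∀ {A : Set} {xs : List A} → (∀ x → x ∈ xs) → ∀ k (v : Vec A k) → v ∈ allVecs xs k
  allVecs-complete every zero    []      = here refl
  allVecs-complete every (suc k) (x ∷ v) =
    ∈-concatMap⁺ (λ y → map (y ∷_) (allVecs _ k)) (lose (every x) (∈-map⁺ (x ∷_) (allVecs-complete every k v)))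

  perms-complete : ∀ {n} {π : Vec (Fin n) n} → IsPerm π → π ∈ perms n
  perms-complete {n} {π} π-perm = ∈-filter⁺ isPerm? (allVecs-complete ∈-allFin n π) π-perm

  isMin-unique : ∀ {n} {S S' : Fin n → Set} → (∀ k → S k → S' k) → (∀ k → S' k → S k) →
    ∀ {p q} → IsMin S p → IsMin S' q → p ≡ q
  isMin-unique S⇒S' S'⇒S (Sp , p-least) (S'q , q-least) =
    toℕ-injective (≤-antisym (p-least _ (S'⇒S _ S'q)) (q-least _ (S⇒S' _ Sp)))

  -- A preference vector determines its outcome: if π and π' agree on the cars
  -- before i, the spots available to car i are the same, hence so is its spot.
  module _ {n} (π π' : Vec (Fin n) n) (C : Vec (Subset n) n)
           (π'-inj : IsPerm π') (O : Outcome π C) (O' : Outcome π' C) where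

    agree-at : ∀ i → (∀ i' → i' <ᶠ i → ∀ k → lookup π k ≡ i' → lookup π' k ≡ i') →
      (∀ i' → i' <ᶠ i → ∀ k → lookup π' k ≡ i' → lookup π k ≡ i') →
      ∀ k → lookup π k ≡ i → lookup π' k ≡ i
    agree-at i before before' k πk≡i with injective⇒surjective (lookup π') (π'-inj _ _) i
    ... | q , π'q≡i = subst (λ z → lookup π' z ≡ i) (sym k≡q) π'q≡i
      where
      k≡q = isMin-unique (λ j (j∈ , free) → j∈ , λ { (i' , lt , e) → free (i' , lt , before' i' lt j e) })
                         (λ j (j∈ , free) → j∈ , λ { (i' , lt , e) → free (i' , lt , before i' lt j e) })
                         (O i k πk≡i) (O' i q π'q≡i)

  outcome-unique : ∀ {n} {π π' : Vec (Fin n) n} {C : Vec (Subset n) n} → IsPerm π → IsPerm π' →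
    Outcome π C → Outcome π' C → π ≡ π'
  outcome-unique {n} {π} {π'} {C} π-inj π'-inj O O' =
    trans (sym (tabulate∘lookup π)) (trans (tabulate-cong same) (tabulate∘lookup π'))
    where
    Agree : ℕ → Set
    Agree m = ∀ i → toℕ i < m → ∀ k → (lookup π k ≡ i → lookup π' k ≡ i) × (lookup π' k ≡ i → lookup π k ≡ i)
    agree : ∀ m → Agree m
    agree zero    i ()
    agree (suc m) i i<m+1 k with m≤n⇒m<n∨m≡n (≤-pred i<m+1)
    ... | inj₁ i<m  = agree m i i<m k
    ... | inj₂ refl = agree-at π π' C π'-inj O O' i (λ i' lt → proj₁ ∘ agree m i' lt) (λ i' lt → proj₂ ∘ agree m i' lt) k
                    , agree-at π' π C π-inj O' O i (λ i' lt → proj₂ ∘ agree m i' lt) (λ i' lt → proj₁ ∘ agree m i' lt) k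
    same : ∀ k → lookup π k ≡ lookup π' k
    same k = sym (proj₁ (agree (suc (toℕ (lookup π k))) (lookup π k) ≤-refl k) refl)

  count-any : ∀ {A B : Set} {R : B → Set} {Q : B → A → Set} (Q? : ∀ b → Decidable (Q b)) →
    (∀ b b' x → R b → R b' → Q b x → Q b' x → b ≡ b') →
    ∀ {L} → All R L → Unique L → ∀ xs →
    count (λ x → any? (λ b → Q? b x) L) xs ≡ sum (map (λ b → count (Q? b) xs) L)
  count-any Q? exclusive []       []         xs = count-none _ (λ _ ()) xs
  count-any {Q = Q} Q? exclusive {b ∷ L} (Rb ∷ RL) (b∉L ∷ uL) xs = trans
    (count-⊎ (Q? b) (λ x → any? (λ b' → Q? b' x) L) (λ x → any? (λ b' → Q? b' x) (b ∷ L))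
       (λ { x (here q) → inj₁ q ; x (there q) → inj₂ q })
       (λ { x (inj₁ q) → here q ; x (inj₂ q) → there q })
       (λ x q → elsewhere x q RL b∉L) xs)
    (cong (count (Q? b) xs +_) (count-any Q? exclusive RL uL xs))
    where
    elsewhere : ∀ x → Q b x → ∀ {L'} → All _ L' → All (b ≢_) L' → ¬ Any (λ b' → Q b' x) L'
    elsewhere x q (Rb' ∷ _)  (b≢b' ∷ _)  (here q')  = b≢b' (exclusive b _ x Rb Rb' q q')
    elsewhere x q (_ ∷ RL')  (_ ∷ b∉L')  (there q') = elsewhere x q RL' b∉L' q'

  -- Each classical parking function has a unique outcome: PF(n) = Σ_π PF(n, π).
  PFtotal-sum : ∀ n → PFtotal n ≡ sum (map (PF n) (perms n))
  PFtotal-sum n = count-any (λ π c → outcome? π (toUppers c))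
    (λ π π' c π-inj π'-inj → outcome-unique {C = toUppers c} π-inj π'-inj)
    (perms-all n) (perms-unique n) (allVecs (allFin n) n)

  IPFtotal-PFtotal : ∀ n c → (∀ π → IsPerm π → IPF n π ≡ c * PF n π) → IPFtotal n ≡ c * PFtotal n
  IPFtotal-PFtotal n c per-π = begin
    IPFtotal n                           ≡⟨ cong sum (map-cong-local (All.map (λ {π} → per-π π) (perms-all n))) ⟩
    sum (map (λ π → c * PF n π) (perms n)) ≡⟨ sum-*ˡ c (PF n) (perms n) ⟩
    c * sum (map (PF n) (perms n))       ≡⟨ cong (c *_) (PFtotal-sum n) ⟨
    c * PFtotal n                        ∎
    where open ≡-Reasoning

module Circle where

  open import Defs using (count; allVecs)
  open FinProducts using (∑-reindex; sum-allFin)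
  open Counting
  open import Data.Nat using (ℕ; zero; suc; _+_; _*_; _^_; _∸_; _≤_; _<_; s≤s; z≤n)
  open import Data.Nat.ListAction using (sum)
  open import Data.Vec using (Vec; []; _∷_; lookup)
  import Data.Vec as Vec
  open import Data.Nat.Properties
  open import Data.Bool using (Bool; true; false; _∨_; if_then_else_)
  open import Data.Bool.Properties using (∨-zeroʳ; ¬-not) renaming (_≟_ to _≟B_)
  open import Data.List using (List; []; _∷_; map; allFin; length)
  open import Data.List.Properties using (map-cong; length-tabulate; map-tabulate; map-∘)
  open import Data.Fin using (Fin; zero; suc; toℕ)
  open import Data.Fin.Properties using (toℕ-injective; toℕ<n) renaming (_≟_ to _≟ᶠ_; suc-injective to fsuc-injective)
  open import Data.Product using (∃; _×_; _,_)
  open import Data.Sum using (_⊎_; inj₁; inj₂)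
  open import Relation.Binary.PropositionalEquality using (_≡_; _≢_; refl; sym; trans; cong; cong₂; subst; module ≡-Reasoning)
  open import Relation.Nullary using (Dec; yes; no; ¬_; does; contradiction)
  open import Relation.Unary using (Decidable)
  open import Data.Empty using (⊥-elim)
  open import Function using (_∘_; id)

  -- The cyclic successor on Fin (suc m): x ↦ x + 1 mod (m + 1).
  σ : ∀ {m} → Fin (suc m) → Fin (suc m)
  σ {zero}  zero    = zero
  σ {suc m} zero    = suc zero
  σ {suc m} (suc x) = lift (σ x)
    where
    lift : Fin (suc m) → Fin (suc (suc m))
    lift zero    = zero
    lift (suc y) = suc (suc y)

  toℕ≤ : ∀ {m} (x : Fin (suc m)) → toℕ x ≤ m
  toℕ≤ x = ≤-pred (toℕ<n x)

  σ-inner : ∀ {m} (x : Fin (suc m)) → toℕ x < m → toℕ (σ x) ≡ suc (toℕ x)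
  σ-inner {suc m} zero    _ = refl
  σ-inner {suc m} (suc x) x<m with σ x | σ-inner x (≤-pred x<m)
  ... | suc _ | e = cong suc e

  σ-last : ∀ {m} (x : Fin (suc m)) → toℕ x ≡ m → σ x ≡ zero
  σ-last {zero}  zero    _ = refl
  σ-last {suc m} (suc x) e with σ x | σ-last x (suc-injective e)
  ... | zero | _ = refl

  σ-injective : ∀ {m} (x y : Fin (suc m)) → σ x ≡ σ y → x ≡ y
  σ-injective {m} x y e with m≤n⇒m<n∨m≡n (toℕ≤ x) | m≤n⇒m<n∨m≡n (toℕ≤ y)
  ... | inj₁ x<m | inj₁ y<m = toℕ-injective (suc-injective (trans (sym (σ-inner x x<m)) (trans (cong toℕ e) (σ-inner y y<m))))
  ... | inj₁ x<m | inj₂ y≡m = ⊥-elim (0≢1+n (trans (sym (cong toℕ (trans e (σ-last y y≡m)))) (σ-inner x x<m)))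
  ... | inj₂ x≡m | inj₁ y<m = ⊥-elim (0≢1+n (trans (sym (cong toℕ (trans (sym e) (σ-last x x≡m)))) (σ-inner y y<m)))
  ... | inj₂ x≡m | inj₂ y≡m = toℕ-injective (trans x≡m (sym y≡m))

  -- Parking on a circle of N = n + 1 spots. An occupancy marks occupied spots with true.
  module CircularParking (n : ℕ) where

    N : ℕ
    N = suc n

    Spot : Set
    Spot = Fin N

    Occupancy : Set
    Occupancy = Spot → Bool

    rotate : ℕ → Spot → Spot
    rotate zero    x = x
    rotate (suc j) x = σ (rotate j x)

    rotate-suc : ∀ j x → rotate (suc j) x ≡ rotate j (σ x)
    rotate-suc zero    x = refl
    rotate-suc (suc j) x = cong σ (rotate-suc j x)

    rotate-+ : ∀ i j x → rotate (i + j) x ≡ rotate i (rotate j x)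
    rotate-+ zero    j x = refl
    rotate-+ (suc i) j x = cong σ (rotate-+ i j x)

    rotate-toℕ : ∀ j x → toℕ x + j ≤ n → toℕ (rotate j x) ≡ toℕ x + j
    rotate-toℕ zero    x _  = sym (+-identityʳ _)
    rotate-toℕ (suc j) x le =
      trans (σ-inner (rotate j x) (subst (_< n) (sym ih) x+j<n)) (trans (cong suc ih) (sym (+-suc (toℕ x) j)))
      where
      x+j<n : toℕ x + j < n
      x+j<n = subst (_≤ n) (+-suc (toℕ x) j) le
      ih = rotate-toℕ j x (<⇒≤ x+j<n)

    rotate-from-zero : ∀ x → rotate (toℕ x) zero ≡ x
    rotate-from-zero x = toℕ-injective (rotate-toℕ (toℕ x) zero (toℕ≤ x))

    reach : ∀ c x → ∃ λ j → j < N × rotate j c ≡ x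
    reach c x with toℕ c ≤? toℕ x
    ... | yes c≤x = toℕ x ∸ toℕ c , s≤s (≤-trans (m∸n≤m (toℕ x) (toℕ c)) (toℕ≤ x)) ,
          toℕ-injective (trans (rotate-toℕ _ c (subst (_≤ n) (sym (m+[n∸m]≡n c≤x)) (toℕ≤ x))) (m+[n∸m]≡n c≤x))
    ... | no c≰x = j , s≤s j≤n ,
          trans (rotate-+ (toℕ x) (suc d) c) (trans (cong (rotate (toℕ x)) wrap) (rotate-from-zero x))
      where
      d = n ∸ toℕ c
      j = toℕ x + suc d
      j≤n : j ≤ n
      j≤n = begin
        toℕ x + suc d ≡⟨ +-suc (toℕ x) d ⟩
        suc (toℕ x) + d ≤⟨ +-monoˡ-≤ d (≰⇒> c≰x) ⟩
        toℕ c + d ≡⟨ m+[n∸m]≡n (toℕ≤ c) ⟩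
        n ∎
        where open ≤-Reasoning
      wrap : rotate (suc d) c ≡ zero
      wrap = σ-last (rotate d c)
        (trans (rotate-toℕ d c (≤-reflexive (m+[n∸m]≡n (toℕ≤ c)))) (m+[n∸m]≡n (toℕ≤ c)))

    -- A car preferring c drives around the circle (with fuel f) to the first free spot.
    park : Occupancy → Spot → ℕ → Spot
    park o c zero    = c
    park o c (suc f) = if o c then park o (σ c) f else c

    occupy : Occupancy → Spot → Occupancy
    occupy o s x = does (x ≟ᶠ s) ∨ o x

    Free : Occupancy → Spot → Set
    Free o x = o x ≡ false

    free? : (o : Occupancy) → Decidable (Free o)
    free? o x = o x ≟B false

    freeCount : Occupancy → ℕ
    freeCount o = count (free? o) (allFin N)

    park-free : ∀ (o : Occupancy) f c j → j < f → Free o (rotate j c) → Free o (park o c f)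
    park-free o (suc f) c zero _ free with o c in occ
    ... | false = occ
    ... | true  = contradiction free λ ()
    park-free o (suc f) c (suc j) j<f free with o c in occ
    ... | false = occ
    ... | true  = park-free o f (σ c) j (≤-pred j<f) (trans (cong o (sym (rotate-suc j c))) free)

    park-finds-free : ∀ (o : Occupancy) c x → Free o x → Free o (park o c N)
    park-finds-free o c x free with reach c x
    ... | j , j<N , c↦x = park-free o N c j j<N (trans (cong o c↦x) free)

    park-rotate : ∀ (o o' : Occupancy) → (∀ x → o' (σ x) ≡ o x) → ∀ f c → park o' (σ c) f ≡ σ (park o c f)
    park-rotate o o' o'σ≡o zero    c = refl
    park-rotate o o' o'σ≡o (suc f) c rewrite o'σ≡o c with o c
    ... | true  = park-rotate o o' o'σ≡o f (σ c)
    ... | false = refl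

    occupy-rotate : ∀ (o o' : Occupancy) → (∀ x → o' (σ x) ≡ o x) → ∀ s x → occupy o' (σ s) (σ x) ≡ occupy o s x
    occupy-rotate o o' o'σ≡o s x = cong₂ _∨_ (same-test (x ≟ᶠ s) (σ x ≟ᶠ σ s)) (o'σ≡o x)
      where
      same-test : (d : Dec (x ≡ s)) (d' : Dec (σ x ≡ σ s)) → does d' ≡ does d
      same-test (yes _)   (yes _)    = refl
      same-test (no _)    (no _)     = refl
      same-test (yes x≡s) (no σx≢σs) = ⊥-elim (σx≢σs (cong σ x≡s))
      same-test (no x≢s)  (yes σx≡σs) = ⊥-elim (x≢s (σ-injective x s σx≡σs))

    occupancy : (ℕ → Spot) → ℕ → Occupancy
    occupancy pr zero    = λ _ → false
    occupancy pr (suc m) = occupy o (park o (pr m) N)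
      where o = occupancy pr m

    spotOf : (ℕ → Spot) → ℕ → Spot
    spotOf pr m = park (occupancy pr m) (pr m) N

    occupancy-rotate : ∀ pr pr' M → (∀ m → m < M → pr' m ≡ σ (pr m)) →
      ∀ x → occupancy pr' M (σ x) ≡ occupancy pr M x
    occupancy-rotate pr pr' zero    _     x = refl
    occupancy-rotate pr pr' (suc M) pr'≡σpr x = begin
      occupy (occupancy pr' M) (park (occupancy pr' M) (pr' M) N) (σ x)
        ≡⟨ cong (λ c → occupy (occupancy pr' M) (park (occupancy pr' M) c N) (σ x)) (pr'≡σpr M ≤-refl) ⟩
      occupy (occupancy pr' M) (park (occupancy pr' M) (σ (pr M)) N) (σ x)
        ≡⟨ cong (λ s → occupy (occupancy pr' M) s (σ x)) (park-rotate (occupancy pr M) (occupancy pr' M) ih N (pr M)) ⟩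
      occupy (occupancy pr' M) (σ (spotOf pr M)) (σ x)
        ≡⟨ occupy-rotate (occupancy pr M) (occupancy pr' M) ih (spotOf pr M) x ⟩
      occupy (occupancy pr M) (spotOf pr M) x ∎
      where
      open ≡-Reasoning
      ih = occupancy-rotate pr pr' M (λ m m<M → pr'≡σpr m (m<n⇒m<1+n m<M))

    occupy-here : ∀ o s → occupy o s s ≡ true
    occupy-here o s with s ≟ᶠ s
    ... | yes _  = refl
    ... | no s≢s = contradiction refl s≢s

    occupy-elsewhere : ∀ o {s x} → ¬ x ≡ s → occupy o s x ≡ o x
    occupy-elsewhere o {s} {x} x≢s with x ≟ᶠ s
    ... | yes x≡s = contradiction x≡s x≢s
    ... | no _    = refl

    occupy-keeps : ∀ o s x → o x ≡ true → occupy o s x ≡ true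
    occupy-keeps o s x occ = trans (cong (does (x ≟ᶠ s) ∨_) occ) (∨-zeroʳ _)

    freeCount-occupy : ∀ o s → Free o s → freeCount o ≡ suc (freeCount (occupy o s))
    freeCount-occupy o s s-free = trans
      (count-⊎ (_≟ᶠ s) (free? (occupy o s)) (free? o) split join disjoint (allFin N))
      (cong (_+ freeCount (occupy o s)) (count-single N s))
      where
      split : ∀ x → Free o x → x ≡ s ⊎ Free (occupy o s) x
      split x x-free with x ≟ᶠ s
      ... | yes x≡s = inj₁ x≡s
      ... | no _    = inj₂ x-free
      join : ∀ x → x ≡ s ⊎ Free (occupy o s) x → Free o x
      join x (inj₁ refl)  = s-free
      join x (inj₂ free') with x ≟ᶠ s
      ... | yes refl = s-free
      ... | no _     = free'
      disjoint : ∀ x → x ≡ s → ¬ Free (occupy o s) x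
      disjoint x refl free' = contradiction (trans (sym (occupy-here o s)) free') λ ()
      count-single : ∀ m (s : Fin m) → count (_≟ᶠ s) (allFin m) ≡ 1
      count-single (suc m) s = trans (cong (count (_≟ᶠ s) ∘ (zero ∷_)) (sym (map-tabulate id suc))) (at s)
        where
        at : ∀ s → count (_≟ᶠ s) (zero ∷ map suc (allFin m)) ≡ 1
        at zero     = trans (count-yes (_≟ᶠ zero) (map suc (allFin m)) refl)
          (cong suc (trans (count-map (_≟ᶠ zero) suc (allFin m)) (count-none _ (λ _ ()) (allFin m))))
        at (suc s') = trans (count-no (_≟ᶠ suc s') {zero} (map suc (allFin m)) λ ())
          (trans (count-map (_≟ᶠ suc s') suc (allFin m))
          (trans (count-cong _ (_≟ᶠ s') (fsuc-injective , cong suc) (allFin m)) (count-single m s')))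

    freeCount-occupancy : ∀ pr m → m ≤ n → freeCount (occupancy pr m) + m ≡ N
    freeCount-occupancy pr zero    _   =
      trans (+-identityʳ _) (trans (count-all (free? (λ _ → false)) (λ _ → refl) (allFin N)) (length-tabulate id))
    freeCount-occupancy pr (suc m) m<n = begin
      freeCount (occupancy pr (suc m)) + suc m   ≡⟨ +-suc _ m ⟩
      suc (freeCount (occupancy pr (suc m))) + m ≡⟨ cong (_+ m) (freeCount-occupy o (spotOf pr m) spot-free) ⟨
      freeCount o + m                            ≡⟨ ih ⟩
      N ∎
      where
      open ≡-Reasoning
      o = occupancy pr m
      ih = freeCount-occupancy pr m (<⇒≤ m<n)
      some-free : 0 < freeCount o
      some-free with freeCount o | ih
      ... | zero  | m≡N = contradiction (≤-trans (n≤1+n (suc n)) (subst (λ k → suc k ≤ n) m≡N m<n)) (<-irrefl refl)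
      ... | suc _ | _   = s≤s z≤n
      spot-free : Free o (spotOf pr m)
      spot-free with count-witness (free? o) (allFin N) some-free
      ... | x , x-free = park-finds-free o (pr m) x x-free

    occupied-later : ∀ pr m d x → occupancy pr m x ≡ true → occupancy pr (d + m) x ≡ true
    occupied-later pr m zero    x occ = occ
    occupied-later pr m (suc d) x occ = occupy-keeps (occupancy pr (d + m)) (spotOf pr (d + m)) x (occupied-later pr m d x occ)

    parked⇒occupied : ∀ pr m j → j < m → occupancy pr m (spotOf pr j) ≡ true
    parked⇒occupied pr m j j<m = subst (λ k → occupancy pr k (spotOf pr j) ≡ true) (m∸n+n≡m j<m)
      (occupied-later pr (suc j) (m ∸ suc j) (spotOf pr j) (occupy-here (occupancy pr j) (spotOf pr j)))

    occupied⇒parked : ∀ pr m x → occupancy pr m x ≡ true → ∃ λ j → j < m × spotOf pr j ≡ x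
    occupied⇒parked pr (suc m) x occ with x ≟ᶠ spotOf pr m
    ... | yes x≡s = m , ≤-refl , sym x≡s
    ... | no _ with occupied⇒parked pr m x occ
    ...   | j , j<m , s≡x = j , m<n⇒m<1+n j<m , s≡x


  -- A vector read as a sequence indexed by ℕ (padded with a default value).
  sequence : ∀ {A : Set} {k} → Vec A k → A → ℕ → A
  sequence []       d m       = d
  sequence (x ∷ v)  d zero    = x
  sequence (x ∷ v)  d (suc m) = sequence v d m

  sequence-map : ∀ {A B : Set} {k} (g : A → B) (v : Vec A k) d d' m → m < k →
    sequence (Vec.map g v) d m ≡ g (sequence v d' m)
  sequence-map g (x ∷ v) d d' zero    _   = refl
  sequence-map g (x ∷ v) d d' (suc m) m<k = sequence-map g v d d' m (≤-pred m<k)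

  sequence-lookup : ∀ {A : Set} {k} (v : Vec A k) d (i : Fin k) → sequence v d (toℕ i) ≡ lookup v i
  sequence-lookup (x ∷ v) d zero    = refl
  sequence-lookup (x ∷ v) d (suc i) = sequence-lookup v d i

  -- Pollak's symmetry argument: every spot is left free by equally many of the
  -- N^n preference sequences, and each sequence leaves exactly one spot free.
  module Symmetry (n : ℕ) where
    open CircularParking n

    allPrefs : ∀ k → List (Vec Spot k)
    allPrefs = allVecs (allFin N)

    final : Vec Spot n → Occupancy
    final v = occupancy (sequence v zero) n

    freeAt : Spot → ℕ
    freeAt s = count (λ v → free? (final v) s) (allPrefs n)

    -- Rotating all preferences is a bijection of Spot^k.
    count-rotate : ∀ k {P : Vec Spot k → Set} (P? : Decidable P) →
      count P? (allPrefs k) ≡ count (P? ∘ Vec.map σ) (allPrefs k)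
    count-rotate zero    P? = trans (count-∷ P? [] []) (sym (count-∷ (P? ∘ Vec.map σ) [] []))
    count-rotate (suc k) P? = begin
      count P? (allPrefs (suc k))
        ≡⟨ count-allVecs-suc P? (allFin N) ⟩
      sum (map g (allFin N))
        ≡⟨ trans (sum-allFin N g) (trans (∑-reindex σ (σ-injective _ _) g) (sym (sum-allFin N (g ∘ σ)))) ⟩
      sum (map (g ∘ σ) (allFin N))
        ≡⟨ cong sum (map-cong (λ x → count-rotate k (P? ∘ (σ x ∷_))) (allFin N)) ⟩
      sum (map (λ x → count (P? ∘ Vec.map σ ∘ (x ∷_)) (allPrefs k)) (allFin N))
        ≡⟨ count-allVecs-suc (P? ∘ Vec.map σ) (allFin N) ⟨
      count (P? ∘ Vec.map σ) (allPrefs (suc k)) ∎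
      where
      open ≡-Reasoning
      g = λ x → count (P? ∘ (x ∷_)) (allPrefs k)

    freeAt-σ : ∀ s → freeAt (σ s) ≡ freeAt s
    freeAt-σ s = trans (count-rotate n (λ v → free? (final v) (σ s)))
      (count-cong _ _ ((λ {v} e → trans (sym (rotated v)) e) , λ {v} e → trans (rotated v) e) (allPrefs n))
      where
      rotated : ∀ v → final (Vec.map σ v) (σ s) ≡ final v s
      rotated v = occupancy-rotate (sequence v zero) (sequence (Vec.map σ v) zero) n
        (λ m m<n → sequence-map σ v zero zero m m<n) s

    freeAt-constant : ∀ s → freeAt s ≡ freeAt zero
    freeAt-constant s = trans (cong freeAt (sym (rotate-from-zero s))) (from-zero (toℕ s))
      where
      from-zero : ∀ j → freeAt (rotate j zero) ≡ freeAt zero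
      from-zero zero    = refl
      from-zero (suc j) = trans (freeAt-σ (rotate j zero)) (from-zero j)

    final-one-free : ∀ v → freeCount (final v) ≡ 1
    final-one-free v = +-cancelʳ-≡ n _ _ (freeCount-occupancy (sequence v zero) n ≤-refl)

    sum-freeAt : sum (map freeAt (allFin N)) ≡ N ^ n
    sum-freeAt = begin
      sum (map freeAt (allFin N))
        ≡⟨ double-count (λ s v → free? (final v) s) (allFin N) (allPrefs n) ⟩
      sum (map (freeCount ∘ final) (allPrefs n))
        ≡⟨ cong sum (map-cong final-one-free (allPrefs n)) ⟩
      sum (map (λ _ → 1) (allPrefs n))
        ≡⟨ sum-const 1 (allPrefs n) ⟩
      length (allPrefs n) * 1
        ≡⟨ *-identityʳ _ ⟩
      length (allPrefs n)
        ≡⟨ length-allVecs (allFin N) n ⟩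
      length (allFin N) ^ n
        ≡⟨ cong (_^ n) (length-tabulate id) ⟩
      N ^ n ∎
      where open ≡-Reasoning

    freeAt-zero : 1 ≤ n → freeAt zero ≡ N ^ (n ∸ 1)
    freeAt-zero (s≤s {n = n-1} _) = *-cancelˡ-≡ (freeAt zero) (N ^ n-1) N (begin
      N * freeAt zero                      ≡⟨ cong (_* freeAt zero) (length-tabulate {n = N} id) ⟨
      length (allFin N) * freeAt zero      ≡⟨ sum-const (freeAt zero) (allFin N) ⟨
      sum (map (λ _ → freeAt zero) (allFin N)) ≡⟨ cong sum (map-cong freeAt-constant (allFin N)) ⟨
      sum (map freeAt (allFin N))          ≡⟨ sum-freeAt ⟩
      N ^ n ∎)
      where open ≡-Reasoning

  -- While spot 0 stays free no car wraps around: circular parking is linear parking.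
  module Linear (n : ℕ) where
    open CircularParking n
    open Symmetry n

    park-at-zero : ∀ o f → Free o zero → park o zero f ≡ zero
    park-at-zero o zero    _    = refl
    park-at-zero o (suc f) free rewrite free = refl

    park-linear : ∀ o f c → Free o zero →
      park o c f ≡ zero ⊎ (toℕ c ≤ toℕ (park o c f) × (∀ x → toℕ c ≤ toℕ x → toℕ x < toℕ (park o c f) → o x ≡ true))
    park-linear o zero    c _ = inj₂ (≤-refl , λ x c≤x x<c → contradiction (≤-trans x<c c≤x) (<-irrefl refl))
    park-linear o (suc f) c zero-free with o c in occ
    ... | false = inj₂ (≤-refl , λ x c≤x x<c → contradiction (≤-trans x<c c≤x) (<-irrefl refl))
    ... | true with m≤n⇒m<n∨m≡n (toℕ≤ c)
    ...   | inj₂ c≡n = inj₁ (trans (cong (λ z → park o z f) (σ-last c c≡n)) (park-at-zero o f zero-free))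
    ...   | inj₁ c<n with park-linear o f (σ c) zero-free
    ...     | inj₁ wrapped = inj₁ wrapped
    ...     | inj₂ (σc≤s , passed) = inj₂ (≤-trans (n≤1+n _) (subst (_≤ toℕ (park o (σ c) f)) (σ-inner c c<n) σc≤s) , passed')
      where
      passed' : ∀ x → toℕ c ≤ toℕ x → toℕ x < toℕ (park o (σ c) f) → o x ≡ true
      passed' x c≤x x<s with toℕ c ≟ toℕ x
      ... | yes c≡x = trans (cong o (sym (toℕ-injective c≡x))) occ
      ... | no  c≢x = passed x (subst (_≤ toℕ x) (sym (σ-inner c c<n)) (≤∧≢⇒< c≤x c≢x)) x<s

    park-stops : ∀ o f c r → toℕ c ≤ toℕ r → toℕ r ∸ toℕ c < f → Free o r →
      (∀ x → toℕ c ≤ toℕ x → toℕ x < toℕ r → o x ≡ true) → park o c f ≡ r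
    park-stops o (suc f) c r c≤r r-c<f r-free passed with toℕ c ≟ toℕ r
    ... | yes c≡r rewrite toℕ-injective c≡r | r-free = refl
    ... | no  c≢r = trans (cong (λ b → if b then park o (σ c) f else c) (passed c ≤-refl c<r))
      (park-stops o f (σ c) r (subst (_≤ toℕ r) (sym σc) c<r) r-σc<f r-free
        (λ x σc≤x → passed x (≤-trans (n≤1+n _) (subst (_≤ toℕ x) σc σc≤x))))
      where
      c<r : toℕ c < toℕ r
      c<r = ≤∧≢⇒< c≤r c≢r
      σc : toℕ (σ c) ≡ suc (toℕ c)
      σc = σ-inner c (≤-trans c<r (toℕ≤ r))
      r-σc<f : toℕ r ∸ toℕ (σ c) < f
      r-σc<f rewrite σc = ≤-pred (subst (_< suc f) (∸-suc c<r) r-c<f)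
        where
        ∸-suc : ∀ {a b} → b < a → a ∸ b ≡ suc (a ∸ suc b)
        ∸-suc {suc a} {zero}  _         = refl
        ∸-suc {suc a} {suc b} (s≤s b<a) = ∸-suc b<a

    occupied-split : ∀ o s x → occupy o s x ≡ true → x ≡ s ⊎ o x ≡ true
    occupied-split o s x occ with x ≟ᶠ s
    ... | yes x≡s = inj₁ x≡s
    ... | no  _   = inj₂ occ

    zero-preferred : ∀ o → occupy o (park o zero N) zero ≡ true
    zero-preferred o with o zero in occ
    ... | true  = ∨-zeroʳ _
    ... | false = occupy-here o zero

    zero-free-before : ∀ pr → Free (occupancy pr n) zero → ∀ m → m ≤ n → Free (occupancy pr m) zero
    zero-free-before pr free-end m m≤n = ¬-not λ occ →
      contradiction (trans (sym (subst (λ k → occupancy pr k zero ≡ true) (m∸n+n≡m m≤n)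
        (occupied-later pr m (n ∸ m) zero occ))) free-end) λ ()

    zero-unpreferred : ∀ pr m → Free (occupancy pr (suc m)) zero → pr m ≢ zero
    zero-unpreferred pr m free pr-m≡0 = contradiction (trans (sym taken) free) λ ()
      where
      taken : occupancy pr (suc m) zero ≡ true
      taken = subst (λ c → occupy (occupancy pr m) (park (occupancy pr m) c N) zero ≡ true) (sym pr-m≡0)
        (zero-preferred (occupancy pr m))

    count-shift : ∀ k {P : Vec Spot k → Set} (P? : Decidable P) → (∀ v → P v → ∀ i → lookup v i ≢ zero) →
      count P? (allPrefs k) ≡ count (P? ∘ Vec.map suc) (allVecs (allFin n) k)
    count-shift zero    P? _       = trans (count-∷ P? [] []) (sym (count-∷ (P? ∘ Vec.map suc) [] []))
    count-shift (suc k) P? nonzero = begin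
      count P? (allPrefs (suc k))
        ≡⟨ count-allVecs-suc P? (allFin N) ⟩
      sum (map g (allFin N))
        ≡⟨ cong (sum ∘ map g ∘ (zero ∷_)) (sym (map-tabulate id suc)) ⟩
      g zero + sum (map g (map suc (allFin n)))
        ≡⟨ cong₂ _+_ g-zero (cong sum (sym (map-∘ (allFin n)))) ⟩
      sum (map (g ∘ suc) (allFin n))
        ≡⟨ cong sum (map-cong (λ x → count-shift k (P? ∘ (suc x ∷_)) (λ v p i → nonzero (suc x ∷ v) p (suc i))) (allFin n)) ⟩
      sum (map (λ x → count (P? ∘ Vec.map suc ∘ (x ∷_)) (allVecs (allFin n) k)) (allFin n))
        ≡⟨ count-allVecs-suc (P? ∘ Vec.map suc) (allFin n) ⟨
      count (P? ∘ Vec.map suc) (allVecs (allFin n) (suc k)) ∎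
      where
      open ≡-Reasoning
      g = λ x → count (P? ∘ (x ∷_)) (allPrefs k)
      g-zero : g zero ≡ 0
      g-zero = count-none (P? ∘ (zero ∷_)) (λ v p → nonzero (zero ∷ v) p zero refl) (allPrefs k)

    freeAt-zero-shift : freeAt zero ≡ count (λ w → free? (final (Vec.map suc w)) zero) (allVecs (allFin n) n)
    freeAt-zero-shift = count-shift n (λ v → free? (final v) zero) nonzero
      where
      nonzero : ∀ v → Free (final v) zero → ∀ i → lookup v i ≢ zero
      nonzero v free i vi≡0 = zero-unpreferred (sequence v zero) (toℕ i)
        (zero-free-before (sequence v zero) free (suc (toℕ i)) (toℕ<n i)) (trans (sequence-lookup v zero i) vi≡0)

module Equivalence where

  open import Defs
  open Counting
  open Circle
  open Membership using (∈upper⁻; ∈upper⁺)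
  open PerPermutation using (taken⇒; ⇒taken)
  open Totals using (perms-all; perms-complete)
  open FinProducts using (injective⇒surjective)
  open import Data.Nat using (ℕ; zero; suc; _∸_; _^_; _≤_; _<_; s≤s)
  open import Data.Nat.Properties
  open import Data.Bool using (true)
  open import Data.Bool.Properties using (¬-not)
  open import Data.List using (allFin)
  open import Data.List.Membership.Propositional using (lose)
  open import Data.List.Membership.Propositional.Properties using (∈-allFin)
  open import Data.List.Properties using (filter-some)
  open import Data.List.Relation.Unary.Any using (Any; any?)
  open import Data.List.Relation.Unary.All using (lookupWith)
  open import Data.Fin.Subset using () renaming (_∈_ to _∈ˢ_)
  open import Data.Vec using (Vec; lookup; tabulate)
  import Data.Vec as Vec
  open import Data.Vec.Properties using (lookup-map; lookup∘tabulate)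
  open import Data.Fin using (Fin; zero; suc; toℕ; fromℕ<)
  open import Data.Fin.Properties using (toℕ-injective; toℕ<n; toℕ-fromℕ<)
    renaming (suc-injective to fsuc-injective; _<?_ to _<ᶠ?_)
  open import Data.Product using (∃; _×_; _,_; proj₁; proj₂)
  open import Data.Sum using (inj₁; inj₂)
  open import Relation.Binary.PropositionalEquality using (_≡_; _≢_; refl; sym; trans; cong; subst; subst₂; module ≡-Reasoning)
  open import Relation.Nullary using (yes; no; ¬_; contradiction)
  open import Relation.Binary.Definitions using (tri<; tri≈; tri>)
  open import Function using (_∘_)

  -- A vector c ∈ [n]^n (0-based) is a classical parking function with some outcome
  -- iff the circular parking with preferences c_i + 1 leaves spot 0 free.
  module _ (n : ℕ) (c : Vec (Fin n) n) where
    open CircularParking n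
    open Linear n

    prefs : ℕ → Spot
    prefs = sequence (Vec.map suc c) zero

    prefs-car : ∀ (i : Fin n) → prefs (toℕ i) ≡ suc (lookup c i)
    prefs-car i = trans (sequence-lookup (Vec.map suc c) zero i) (lookup-map i suc c)

    upper-car : ∀ (i : Fin n) → lookup (toUppers c) i ≡ upper (lookup c i)
    upper-car i = lookup-map i upper c

    -- If π is an outcome of c, the circular parking puts car π_p at spot p + 1.
    module FromOutcome (π : Vec (Fin n) n) (π-inj : IsPerm π) (O : Outcome π (toUppers c)) where

      Invariant : ℕ → Set
      Invariant m = Free (occupancy prefs m) zero
                  × (∀ k → occupancy prefs m (suc k) ≡ true → toℕ (lookup π k) < m)
                  × (∀ k → toℕ (lookup π k) < m → occupancy prefs m (suc k) ≡ true)

      parks-at-π : ∀ m → Invariant m → ∀ i p → toℕ i ≡ m → lookup π p ≡ i → spotOf prefs m ≡ suc p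
      parks-at-π m (_ , occupied⇒ , ⇒occupied) i p i≡m πp≡i =
        trans (cong (λ s → park (occupancy prefs m) s N) (trans (cong prefs (sym i≡m)) (prefs-car i)))
          (park-stops (occupancy prefs m) N (suc cᵢ) (suc p) (s≤s cᵢ≤p)
            (s≤s (≤-trans (m∸n≤m (toℕ p) (toℕ cᵢ)) (<⇒≤ (toℕ<n p))))
            (¬-not (λ occ → <-irrefl πp≡m (occupied⇒ p occ)))
            passed)
        where
        cᵢ = lookup c i
        leftmost = O i p πp≡i
        πp≡m : toℕ (lookup π p) ≡ m
        πp≡m = trans (cong toℕ πp≡i) i≡m
        cᵢ≤p : toℕ cᵢ ≤ toℕ p
        cᵢ≤p = ∈upper⁻ (subst (p ∈ˢ_) (upper-car i) (proj₁ (proj₁ leftmost)))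
        -- Spots cᵢ + 1, …, p hold cars with labels below i (else p would not be leftmost).
        passed : ∀ x → suc (toℕ cᵢ) ≤ toℕ x → toℕ x < suc (toℕ p) → occupancy prefs m x ≡ true
        passed (suc k) cᵢ<k+1 k<p+1 with lookup π k <ᶠ? i
        ... | yes πk<i = ⇒occupied k (subst (toℕ (lookup π k) <_) i≡m πk<i)
        ... | no  πk≮i = contradiction (proj₂ leftmost k (k∈ , πk≮i ∘ taken⇒ π)) (<⇒≱ (≤-pred k<p+1))
          where k∈ = subst (k ∈ˢ_) (sym (upper-car i)) (∈upper⁺ (≤-pred cᵢ<k+1))

      invariant : ∀ m → m ≤ n → Invariant m
      invariant zero    _   = refl , (λ _ ()) , (λ _ ())
      invariant (suc m) m<n = zero-free , occupied⇒ , ⇒occupied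
        where
        ih = invariant m (<⇒≤ m<n)
        i = fromℕ< m<n
        i≡m : toℕ i ≡ m
        i≡m = toℕ-fromℕ< m<n
        p = proj₁ (injective⇒surjective (lookup π) (π-inj _ _) i)
        πp≡i = proj₂ (injective⇒surjective (lookup π) (π-inj _ _) i)
        spot≡ = parks-at-π m ih i p i≡m πp≡i
        zero-free : Free (occupancy prefs (suc m)) zero
        zero-free = trans (cong (λ s → occupy (occupancy prefs m) s zero) spot≡)
          (trans (occupy-elsewhere (occupancy prefs m) {suc p} λ ()) (proj₁ ih))
        occupied⇒ : ∀ k → occupancy prefs (suc m) (suc k) ≡ true → toℕ (lookup π k) < suc m
        occupied⇒ k occ with occupied-split (occupancy prefs m) (spotOf prefs m) (suc k) occ
        ... | inj₁ k+1≡s = ≤-reflexive (cong suc (trans (cong (toℕ ∘ lookup π) (fsuc-injective (trans k+1≡s spot≡)))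
                                                         (trans (cong toℕ πp≡i) i≡m)))
        ... | inj₂ occ'  = m<n⇒m<1+n (proj₁ (proj₂ ih) k occ')
        ⇒occupied : ∀ k → toℕ (lookup π k) < suc m → occupancy prefs (suc m) (suc k) ≡ true
        ⇒occupied k πk<m+1 with m≤n⇒m<n∨m≡n (≤-pred πk<m+1)
        ... | inj₁ πk<m = occupy-keeps (occupancy prefs m) (spotOf prefs m) (suc k) (proj₂ (proj₂ ih) k πk<m)
        ... | inj₂ πk≡m = subst (λ s → occupy (occupancy prefs m) s (suc k) ≡ true)
                            (trans (cong suc k≡p) (sym spot≡)) (occupy-here (occupancy prefs m) (suc k))
          where
          k≡p : k ≡ p
          k≡p = π-inj k p (trans (toℕ-injective (trans πk≡m (sym i≡m))) (sym πp≡i))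

      zero-free : Free (occupancy prefs n) zero
      zero-free = proj₁ (invariant n ≤-refl)

    -- Conversely, if spot 0 stays free, the car parked at spot k + 1 defines an outcome.
    module ToOutcome (zero-free-end : Free (occupancy prefs n) zero) where

      zero-free-at : ∀ m → m ≤ n → Free (occupancy prefs m) zero
      zero-free-at = zero-free-before prefs zero-free-end

      spot-free : ∀ m → m ≤ n → Free (occupancy prefs m) (spotOf prefs m)
      spot-free m m≤n = park-finds-free (occupancy prefs m) (prefs m) zero (zero-free-at m m≤n)

      spot-nonzero : ∀ m → m < n → spotOf prefs m ≢ zero
      spot-nonzero m m<n s≡0 = contradiction
        (trans (sym (subst (λ s → occupancy prefs (suc m) s ≡ true) s≡0 (occupy-here (occupancy prefs m) (spotOf prefs m)))) (zero-free-at (suc m) m<n))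
        λ ()

      spot-injective : ∀ j m → j < n → m < n → spotOf prefs j ≡ spotOf prefs m → j ≡ m
      spot-injective j m j<n m<n same with <-cmp j m
      ... | tri≈ _ j≡m _ = j≡m
      ... | tri< j<m _ _ = contradiction (trans (sym (subst (λ s → occupancy prefs m s ≡ true) same
                             (parked⇒occupied prefs m j j<m))) (spot-free m (<⇒≤ m<n))) λ ()
      ... | tri> _ _ m<j = contradiction (trans (sym (subst (λ s → occupancy prefs j s ≡ true) (sym same)
                             (parked⇒occupied prefs j m m<j))) (spot-free j (<⇒≤ j<n))) λ ()

      spot-linear : ∀ m → m < n → toℕ (prefs m) ≤ toℕ (spotOf prefs m)
        × (∀ x → toℕ (prefs m) ≤ toℕ x → toℕ x < toℕ (spotOf prefs m) → occupancy prefs m x ≡ true)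
      spot-linear m m<n with park-linear (occupancy prefs m) N (prefs m) (zero-free-at m (<⇒≤ m<n))
      ... | inj₁ s≡0   = contradiction s≡0 (spot-nonzero m m<n)
      ... | inj₂ right = right

      -- Spot 0 is the only free spot, so every other spot holds a car.
      all-occupied : ∀ k → occupancy prefs n (suc k) ≡ true
      all-occupied k = ¬-not λ k+1-free → <-irrefl refl (subst (0 <_) none-left
        (filter-some (free? o') (lose (∈-allFin (suc k)) (trans (occupy-elsewhere o {zero} λ ()) k+1-free))))
        where
        o = occupancy prefs n
        o' = occupy o zero
        none-left : freeCount o' ≡ 0
        none-left = suc-injective (trans (sym (freeCount-occupy o zero zero-free-end))
          (+-cancelʳ-≡ n _ _ (freeCount-occupancy prefs n ≤-refl)))

      car-at : ∀ (k : Fin n) → ∃ λ j → j < n × spotOf prefs j ≡ suc k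
      car-at k = occupied⇒parked prefs n (suc k) (all-occupied k)

      π : Vec (Fin n) n
      π = tabulate (λ k → fromℕ< (proj₁ (proj₂ (car-at k))))

      π-spot : ∀ k → spotOf prefs (toℕ (lookup π k)) ≡ suc k
      π-spot k = trans (cong (spotOf prefs) (trans (cong toℕ (lookup∘tabulate _ k)) (toℕ-fromℕ< _)))
                       (proj₂ (proj₂ (car-at k)))

      π-perm : IsPerm π
      π-perm p q πp≡πq = fsuc-injective (trans (sym (π-spot p)) (trans (cong (spotOf prefs ∘ toℕ) πp≡πq) (π-spot q)))

      outcome : Outcome π (toUppers c)
      outcome i p πp≡i = (p∈ , λ t → <-irrefl (cong toℕ πp≡i) (taken⇒ π t)) , leftmost
        where
        m = toℕ i
        spot≡ : spotOf prefs m ≡ suc p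
        spot≡ = trans (cong (spotOf prefs ∘ toℕ) (sym πp≡i)) (π-spot p)
        cᵢ = lookup c i
        linear = spot-linear m (toℕ<n i)
        cᵢ≤p : toℕ cᵢ ≤ toℕ p
        cᵢ≤p = ≤-pred (subst₂ _≤_ (cong toℕ (prefs-car i)) (cong toℕ spot≡) (proj₁ linear))
        p∈ : p ∈ˢ lookup (toUppers c) i
        p∈ = subst (p ∈ˢ_) (sym (upper-car i)) (∈upper⁺ cᵢ≤p)
        -- A spot k < p of C_i holds a car that parked before car i.
        leftmost : ∀ k → k ∈ˢ lookup (toUppers c) i × ¬ Taken π i k → toℕ p ≤ toℕ k
        leftmost k (k∈ , k-free) with toℕ k <? toℕ p
        ... | no  k≮p = ≮⇒≥ k≮p
        ... | yes k<p = contradiction (⇒taken π (subst (_< m) (sym πk≡j) j<m)) k-free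
          where
          cᵢ≤k = ∈upper⁻ (subst (k ∈ˢ_) (upper-car i) k∈)
          occ : occupancy prefs m (suc k) ≡ true
          occ = proj₂ linear (suc k) (subst (_≤ suc (toℕ k)) (sym (cong toℕ (prefs-car i))) (s≤s cᵢ≤k))
                  (subst (suc (toℕ k) <_) (sym (cong toℕ spot≡)) (s≤s k<p))
          parked = occupied⇒parked prefs m (suc k) occ
          j = proj₁ parked
          j<m = proj₁ (proj₂ parked)
          πk≡j : toℕ (lookup π k) ≡ j
          πk≡j = spot-injective _ _ (toℕ<n (lookup π k)) (<-trans j<m (toℕ<n i))
                   (trans (π-spot k) (sym (proj₂ (proj₂ parked))))

      has-outcome : Any (λ π → Outcome π (toUppers c)) (perms n)
      has-outcome = lose (perms-complete {π = π} π-perm) outcome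

    outcome⇒zero-free : Any (λ π → Outcome π (toUppers c)) (perms n) → Free (occupancy prefs n) zero
    outcome⇒zero-free = lookupWith (λ {π} π-perm O → FromOutcome.zero-free π π-perm O) (perms-all n)

    zero-free⇒outcome : Free (occupancy prefs n) zero → Any (λ π → Outcome π (toUppers c)) (perms n)
    zero-free⇒outcome = ToOutcome.has-outcome

  PFtotal-formula : ∀ n → 1 ≤ n → PFtotal n ≡ suc n ^ (n ∸ 1)
  PFtotal-formula n 1≤n = begin
    PFtotal n                                      ≡⟨ count-cong has-outcome? zero-free? equivalent vectors ⟩
    count zero-free? vectors                       ≡⟨ freeAt-zero-shift ⟨
    freeAt zero                                    ≡⟨ freeAt-zero 1≤n ⟩
    suc n ^ (n ∸ 1)                                ∎
    where
    open ≡-Reasoning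
    open CircularParking n
    open Symmetry n
    open Linear n
    vectors = allVecs (allFin n) n
    has-outcome? = λ (c : Vec (Fin n) n) → any? (λ π → outcome? π (toUppers c)) (perms n)
    zero-free? = λ (c : Vec (Fin n) n) → free? (final (Vec.map suc c)) zero
    equivalent = (λ {c} → outcome⇒zero-free n c) , (λ {c} → zero-free⇒outcome n c)

open import Defs
open import Data.Nat using (ℕ; suc; _*_; _∸_; _^_; _≤_; _!)
open import Data.Fin using (Fin)
open import Data.Vec using (Vec)
open import Data.Product using (_×_)
open import Data.Product using (_,_; proj₁)
open import Data.Nat.Properties using (*-comm)
open import Relation.Binary.PropositionalEquality using (_≡_; cong; sym; trans)
open PerPermutation using (PF-prodA; IPF-prodA)
open Totals using (IPFtotal-PFtotal)
open Equivalence using (PFtotal-formula)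

theorem1p3 : ∀ (n : ℕ) → 1 ≤ n →
    (∀ (π : Vec (Fin n) n) → IsPerm π →
      (IPF n π ≡ n ! * PF n π) × (n ! * PF n π ≡ n ! * prodA π))
    × (IPFtotal n ≡ n ! * PFtotal n) × (n ! * PFtotal n ≡ n ! * (suc n ^ (n ∸ 1)))
theorem1p3 n 1≤n = per-permutation , total , cong (n ! *_) (PFtotal-formula n 1≤n)
  where
  per-permutation : ∀ π → IsPerm π → (IPF n π ≡ n ! * PF n π) × (n ! * PF n π ≡ n ! * prodA π)
  per-permutation π π-perm =
    trans (IPF-prodA π π-perm) (trans (*-comm (prodA π) (n !)) (cong (n ! *_) (sym (PF-prodA π π-perm))))
    , cong (n ! *_) (PF-prodA π π-perm)
  total : IPFtotal n ≡ n ! * PFtotal n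
  total = IPFtotal-PFtotal n (n !) (λ π π-perm → proj₁ (per-permutation π π-perm))
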